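{- Let $A_k(x)=\frac{1}{2}(\mathcal{D}_{12\ldots k}(x)+\mathcal{D}_{12\ldots k}(-x))$ and $B_k(x)=\frac{1}{2}(\mathcal{D}_{12\ldots k}(x)-\mathcal{D}_{12\ldots k}(-x))$ for all $k\geq 0$. Then $$A_k(x)=F_k(x),\qquad B_k(x)=xF_{k-1}(x), \quad \mbox{and}\quad \mathcal{D}_{12\dots k}(x)=F_k(x)+xF_{k-1}(x).$$
   Context: A permutation $\pi$ is a Dumont permutation (of the first kind) if each even integer in $\pi$ is followed by a smaller integer, and each odd integer is either followed by a larger integer or is the last element of $\pi$. A permutation avoids a pattern $\tau$ if it has no subsequence order-isomorphic to $\tau$. For a pattern $\tau$, let $\mathcal{D}_\tau(n)$ be the number of Dumont permutations of length $n$ that avoid both $132$ and $\tau$, and $\mathcal{D}_\tau(x)=\sum_{n\geq0}\mathcal{D}_\tau(n)x^n$. For $r\geq2$ consider the recurrence $Q_r(x)=1+\frac{x^2Q_{r-1}(x)}{1-x^2Q_{r-2}(x)}$; $F_r(x)$ denotes its solution with $Q_0(x)=0$, $Q_1(x)=1$ (so e.g. $F_2=1+x^2$, $F_3=\frac{1+x^4}{1-x^2}$). -}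

module Defs where

open import Data.Nat using (ℕ; zero; suc; _∸_; _<ᵇ_; _≡ᵇ_; _%_)
open import Data.Bool using (Bool; true; false; _∧_; _∨_; not; if_then_else_)
open import Data.List using (List; []; _∷_; map; _++_; concatMap; length; upTo)
open import Data.Integer using (ℤ; +_; _+_; _*_; -_)

words : ℕ → List ℕ → List (List ℕ)
words zero    al = [] ∷ []
words (suc m) al = concatMap (λ a → map (a ∷_) (words m al)) al

elemB : ℕ → List ℕ → Bool
elemB a []      = false
elemB a (b ∷ w) = (a ≡ᵇ b) ∨ elemB a w

distinct : List ℕ → Bool
distinct []      = true
distinct (a ∷ w) = not (elemB a w) ∧ distinct w

filterB : {A : Set} → (A → Bool) → List A → List A
filterB p []      = []
filterB p (x ∷ xs) = if p x then x ∷ filterB p xs else filterB p xs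

oneTo : ℕ → List ℕ
oneTo n = map suc (upTo n)

perms : ℕ → List (List ℕ)
perms n = filterB distinct (words n (oneTo n))

subseqs : ℕ → List ℕ → List (List ℕ)
subseqs zero    w       = [] ∷ []
subseqs (suc k) []      = []
subseqs (suc k) (a ∷ w) = map (a ∷_) (subseqs k w) ++ subseqs (suc k) w

beq : Bool → Bool → Bool
beq true  b = b
beq false b = not b

sameOrd : ℕ → ℕ → List ℕ → List ℕ → Bool
sameOrd a b []      []      = true
sameOrd a b (c ∷ s) (d ∷ t) = beq (a <ᵇ c) (b <ᵇ d) ∧ sameOrd a b s t
sameOrd a b _       _       = false

orderIso : List ℕ → List ℕ → Bool
orderIso []      []      = true
orderIso (a ∷ s) (b ∷ t) = sameOrd a b s t ∧ orderIso s t
orderIso _       _       = false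

anyB : {A : Set} → (A → Bool) → List A → Bool
anyB p []       = false
anyB p (x ∷ xs) = p x ∨ anyB p xs

contains : List ℕ → List ℕ → Bool
contains τ w = anyB (λ s → orderIso s τ) (subseqs (length τ) w)

avoids : List ℕ → List ℕ → Bool
avoids τ w = not (contains τ w)

pat132 : List ℕ
pat132 = 1 ∷ 3 ∷ 2 ∷ []

incPat : ℕ → List ℕ
incPat k = oneTo k

evenB : ℕ → Bool
evenB n = n % 2 ≡ᵇ 0

dumont : List ℕ → Bool
dumont []          = true
dumont (a ∷ [])    = not (evenB a)
dumont (a ∷ b ∷ w) = (if evenB a then b <ᵇ a else a <ᵇ b) ∧ dumont (b ∷ w)

countB : {A : Set} → (A → Bool) → List A → ℕ
countB p []       = 0
countB p (x ∷ xs) = if p x then suc (countB p xs) else countB p xs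

Dcount : List ℕ → ℕ → ℕ
Dcount τ n = countB (λ w → dumont w ∧ avoids pat132 w ∧ avoids τ w) (perms n)

Series : Set
Series = ℕ → ℤ

Dgf : List ℕ → Series
Dgf τ n = + Dcount τ n

zeroS : Series
zeroS _ = + 0

oneS : Series
oneS zero    = + 1
oneS (suc _) = + 0

_⊕_ : Series → Series → Series
(f ⊕ g) n = f n + g n

sumTo : (ℕ → ℤ) → ℕ → ℤ
sumTo h zero    = h zero
sumTo h (suc n) = sumTo h n + h (suc n)

_⊛_ : Series → Series → Series
(f ⊛ g) n = sumTo (λ i → f i * g (n ∸ i)) n

xS : Series → Series
xS f zero    = + 0
xS f (suc n) = f n

negX : Series → Series
negX f n = if evenB n then f n else - f n

powS : Series → ℕ → Series
powS g zero    = oneS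
powS g (suc j) = g ⊛ powS g j

-- 1/(1 - g) for a series g with zero constant term: sum_{j} g^j
-- (coefficient n only needs j ≤ n)
geoS : Series → Series
geoS g n = sumTo (λ j → powS g j n) n

F : ℕ → Series
F zero          = zeroS
F (suc zero)    = oneS
F (suc (suc r)) = oneS ⊕ ((xS (xS (F (suc r)))) ⊛ geoS (xS (xS (F r))))

{-# OPTIONS --safe #-}
-- In a 132-avoiding permutation every entry before the maximum is larger than every entry after it.
-- In a Dumont permutation of odd length 2m+1 the odd maximum cannot be followed by anything, so it is
-- last, and deleting it gives 𝒟_k(2m+1) = 𝒟_{k-1}(2m) (writing 𝒟_k for 𝒟_{12…k}). In even length 2m+2
-- the even maximum N is followed by something, and the odd value M = N - 1, which can only be followed
-- by N, is either last, π = N α M, or directly before N, π = γ M N β, where γ is a shift of a Dumont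
-- permutation α by |β|; the least entry |β| + 1 of γ ascends, hence is odd, so |β| = 2(m - i) is even.
-- An increasing subsequence of N α M is one of α followed by M; one of γ M N β lies in γ M N or in β. So
--   𝒟_k(2m+2) = 𝒟_{k-1}(2m) + Σ_{i<m} 𝒟_{k-2}(2i) 𝒟_k(2m-2i).
-- The series F_k are even, and H = x²F_{k-1}/(1 - x²F_{k-2}) = F_k - 1 satisfies H = x²F_{k-1} + x²F_{k-2}·H,
-- which gives the same recurrence for their coefficients. Hence F_k is the even part of 𝒟_k and xF_{k-1}
-- its odd part.
module Submission where

open import Defs
open import Data.Bool.Base using (Bool; true; false; _∧_; _∨_; not; if_then_else_)
open import Data.Bool.Properties
  using (∧-assoc; ∧-identityʳ; ∧-zeroʳ; ∨-assoc; ∨-identityʳ; ∨-zeroʳ; ¬-not; T-≡)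
open import Data.Empty using (⊥; ⊥-elim)
open import Data.List.Base
  using (List; []; _∷_; _++_; map; concatMap; length; upTo; applyUpTo; cartesianProduct; cartesianProductWith)
import Data.List.Properties as List
open import Data.List.Membership.Propositional using (_∈_; _∉_)
open import Data.List.Membership.Propositional.Properties
open import Data.List.Relation.Binary.Subset.Propositional using (_⊆_)
open import Data.List.Relation.Unary.All as All using (All; []; _∷_)
import Data.List.Relation.Unary.All.Properties as All
open import Data.List.Relation.Unary.All.Properties using (¬Any⇒All¬)
open import Data.List.Relation.Unary.Any using (here; there)
open import Data.List.Relation.Unary.Unique.Propositional using (Unique; []; _∷_)
import Data.List.Relation.Unary.Unique.Propositional.Properties as Unique
open import Data.Nat.Base using (ℕ; zero; suc; _∸_; _≤_; _<_; z≤n; s≤s; _<ᵇ_; _≡ᵇ_)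
import Data.Nat.Base as ℕ
import Data.Nat.Properties as ℕ
open import Data.Nat.Properties using (_≟_)
open import Data.List.Membership.DecPropositional _≟_ using (_∈?_)
open import Data.Nat.Induction using (<-rec)
open import Data.Product.Base using (_×_; _,_; ∃; proj₁; proj₂)
open import Data.Sum.Base using (_⊎_; inj₁; inj₂)
open import Function.Base using (_∘_; case_of_)
open import Function.Bundles using (Equivalence)
open import Relation.Nullary using (yes; no)
open import Relation.Binary.PropositionalEquality

double : ℕ → ℕ
double zero    = zero
double (suc m) = suc (suc (double m))

parity : ∀ n → (∃ λ m → n ≡ double m) ⊎ (∃ λ m → n ≡ suc (double m))
parity zero    = inj₁ (0 , refl)
parity (suc n) with parity n
... | inj₁ (m , refl) = inj₂ (m , refl)
... | inj₂ (m , refl) = inj₁ (suc m , refl)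

double-∸ : ∀ m t → double m ∸ double t ≡ double (m ∸ t)
double-∸ m       zero    = refl
double-∸ zero    (suc t) = refl
double-∸ (suc m) (suc t) = double-∸ m t

suc-double-∸ : ∀ m t → double t ≤ suc (double m) → suc (double m) ∸ double t ≡ suc (double (m ∸ t))
suc-double-∸ m       zero    _                 = refl
suc-double-∸ (suc m) (suc t) (s≤s (s≤s 2t≤2m+1)) = suc-double-∸ m t 2t≤2m+1

double-injective : ∀ {a b} → double a ≡ double b → a ≡ b
double-injective {zero}  {zero}  _  = refl
double-injective {suc a} {suc b} eq = cong suc (double-injective (ℕ.suc-injective (ℕ.suc-injective eq)))

double-cancel-≤ : ∀ {a b} → double a ≤ double b → a ≤ b
double-cancel-≤ {zero}          _              = z≤n
double-cancel-≤ {suc a} {suc b} (s≤s (s≤s le)) = s≤s (double-cancel-≤ le)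

evenB-double : ∀ m → evenB (double m) ≡ true
evenB-double zero    = refl
evenB-double (suc m) = evenB-double m

evenB-suc-double : ∀ m → evenB (suc (double m)) ≡ false
evenB-suc-double zero    = refl
evenB-suc-double (suc m) = evenB-suc-double m

evenB-suc-false⇒double : ∀ j → evenB (suc j) ≡ false → ∃ λ t → j ≡ double t
evenB-suc-false⇒double j odd with parity j
... | inj₁ j≡2t       = j≡2t
... | inj₂ (t , refl) = case trans (sym (evenB-double (suc t))) odd of λ ()

module PowerSeries where

  open import Data.Integer.Base using (ℤ; +_; _+_; _*_)
  import Data.Integer.Properties as ℤ
  open import Algebra.Properties.CommutativeSemigroup ℤ.+-commutativeSemigroup
    using () renaming (interchange to +-interchange)

  sumTo-cong : ∀ {f g : ℕ → ℤ} n → (∀ i → i ≤ n → f i ≡ g i) → sumTo f n ≡ sumTo g n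
  sumTo-cong zero    f≗g = f≗g zero z≤n
  sumTo-cong (suc n) f≗g =
    cong₂ _+_ (sumTo-cong n (λ i i≤n → f≗g i (ℕ.m≤n⇒m≤1+n i≤n))) (f≗g (suc n) ℕ.≤-refl)

  sumTo-zero : ∀ (f : ℕ → ℤ) n → (∀ i → i ≤ n → f i ≡ + 0) → sumTo f n ≡ + 0
  sumTo-zero f n f≗0 = trans (sumTo-cong n f≗0) (zeros n)
    where
    zeros : ∀ n → sumTo (λ _ → + 0) n ≡ + 0
    zeros zero    = refl
    zeros (suc n) = trans (ℤ.+-identityʳ _) (zeros n)

  sumTo-+ : ∀ (f g : ℕ → ℤ) n → sumTo (λ i → f i + g i) n ≡ sumTo f n + sumTo g n
  sumTo-+ f g zero    = refl
  sumTo-+ f g (suc n) = begin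
    sumTo (λ i → f i + g i) n + (f (suc n) + g (suc n))
      ≡⟨ cong (_+ (f (suc n) + g (suc n))) (sumTo-+ f g n) ⟩
    (sumTo f n + sumTo g n) + (f (suc n) + g (suc n))
      ≡⟨ +-interchange (sumTo f n) (sumTo g n) (f (suc n)) (g (suc n)) ⟩
    (sumTo f n + f (suc n)) + (sumTo g n + g (suc n)) ∎
    where open ≡-Reasoning

  sumTo-*ˡ : ∀ c (f : ℕ → ℤ) n → sumTo (λ i → c * f i) n ≡ c * sumTo f n
  sumTo-*ˡ c f zero    = refl
  sumTo-*ˡ c f (suc n) =
    trans (cong (_+ c * f (suc n)) (sumTo-*ˡ c f n)) (sym (ℤ.*-distribˡ-+ c (sumTo f n) (f (suc n))))

  sumTo-*ʳ : ∀ c (f : ℕ → ℤ) n → sumTo (λ i → f i * c) n ≡ sumTo f n * c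
  sumTo-*ʳ c f zero    = refl
  sumTo-*ʳ c f (suc n) =
    trans (cong (_+ f (suc n) * c) (sumTo-*ʳ c f n)) (sym (ℤ.*-distribʳ-+ c (sumTo f n) (f (suc n))))

  sumTo-unconsˡ : ∀ (f : ℕ → ℤ) n → sumTo f (suc n) ≡ f 0 + sumTo (λ i → f (suc i)) n
  sumTo-unconsˡ f zero    = refl
  sumTo-unconsˡ f (suc n) =
    trans (cong (_+ f (suc (suc n))) (sumTo-unconsˡ f n)) (ℤ.+-assoc (f 0) _ _)

  sumTo-reverse : ∀ (f : ℕ → ℤ) n → sumTo f n ≡ sumTo (λ i → f (n ∸ i)) n
  sumTo-reverse f zero    = refl
  sumTo-reverse f (suc n) = begin
    sumTo f n + f (suc n)                       ≡⟨ cong (_+ f (suc n)) (sumTo-reverse f n) ⟩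
    sumTo (λ i → f (n ∸ i)) n + f (suc n)       ≡⟨ ℤ.+-comm _ (f (suc n)) ⟩
    f (suc n) + sumTo (λ i → f (n ∸ i)) n       ≡⟨ sym (sumTo-unconsˡ (λ i → f (suc n ∸ i)) n) ⟩
    sumTo (λ i → f (suc n ∸ i)) (suc n)         ∎
    where open ≡-Reasoning

  sumTo-swap : ∀ (T : ℕ → ℕ → ℤ) A B →
    sumTo (λ i → sumTo (T i) B) A ≡ sumTo (λ j → sumTo (λ i → T i j) A) B
  sumTo-swap T zero    B = refl
  sumTo-swap T (suc A) B =
    trans (cong (_+ sumTo (T (suc A)) B) (sumTo-swap T A B))
          (sym (sumTo-+ (λ j → sumTo (λ i → T i j) A) (T (suc A)) B))

  sumTo-triangle : ∀ (T : ℕ → ℕ → ℤ) n →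
    sumTo (λ i → sumTo (T i) i) n ≡ sumTo (λ j → sumTo (λ l → T (j ℕ.+ l) j) (n ∸ j)) n
  sumTo-triangle T zero    = refl
  sumTo-triangle T (suc n) = begin
    sumTo (λ i → sumTo (T i) i) n + (sumTo (T (suc n)) n + T (suc n) (suc n))
      ≡⟨ cong (_+ (sumTo (T (suc n)) n + T (suc n) (suc n))) (sumTo-triangle T n) ⟩
    sumTo (column n) n + (sumTo (T (suc n)) n + T (suc n) (suc n))
      ≡⟨ sym (ℤ.+-assoc (sumTo (column n) n) _ _) ⟩
    (sumTo (column n) n + sumTo (T (suc n)) n) + T (suc n) (suc n)
      ≡⟨ cong₂ _+_ (sym (sumTo-+ (column n) (T (suc n)) n)) corner ⟩
    sumTo (λ j → column n j + T (suc n) j) n + column (suc n) (suc n)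
      ≡⟨ cong (_+ column (suc n) (suc n)) (sumTo-cong n extend-column) ⟩
    sumTo (column (suc n)) n + column (suc n) (suc n) ∎
    where
    open ≡-Reasoning
    column : ℕ → ℕ → ℤ
    column n j = sumTo (λ l → T (j ℕ.+ l) j) (n ∸ j)
    corner : T (suc n) (suc n) ≡ column (suc n) (suc n)
    corner rewrite ℕ.n∸n≡0 n | ℕ.+-identityʳ n = refl
    extend-column : ∀ j → j ≤ n → column n j + T (suc n) j ≡ column (suc n) j
    extend-column j j≤n rewrite ℕ.+-∸-assoc 1 j≤n =
      cong (λ i → column n j + T i j) (trans (cong suc (sym (ℕ.m+[n∸m]≡n j≤n))) (sym (ℕ.+-suc j (n ∸ j))))

  sumTo-padʳ : ∀ (f : ℕ → ℤ) {M N} → M ≤ N → (∀ j → M < j → f j ≡ + 0) → sumTo f N ≡ sumTo f M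
  sumTo-padʳ f {M} {zero}  z≤n   _ = refl
  sumTo-padʳ f {M} {suc N} M≤1+N f≗0 with ℕ.m≤n⇒m<n∨m≡n M≤1+N
  ... | inj₂ refl       = refl
  ... | inj₁ (s≤s M≤N) =
    trans (cong₂ _+_ (sumTo-padʳ f M≤N f≗0) (f≗0 (suc N) (s≤s M≤N))) (ℤ.+-identityʳ _)

  infix 4 _≈_
  _≈_ : Series → Series → Set
  f ≈ g = ∀ n → f n ≡ g n

  ⊛-cong : ∀ {f f′ g g′} → f ≈ f′ → g ≈ g′ → f ⊛ g ≈ f′ ⊛ g′
  ⊛-cong f≈f′ g≈g′ n = sumTo-cong n (λ i _ → cong₂ _*_ (f≈f′ i) (g≈g′ (n ∸ i)))

  ⊛-comm : ∀ f g → f ⊛ g ≈ g ⊛ f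
  ⊛-comm f g n = begin
    sumTo (λ i → f i * g (n ∸ i)) n                 ≡⟨ sumTo-reverse _ n ⟩
    sumTo (λ i → f (n ∸ i) * g (n ∸ (n ∸ i))) n     ≡⟨ sumTo-cong n swap ⟩
    sumTo (λ i → g i * f (n ∸ i)) n                 ∎
    where
    open ≡-Reasoning
    swap : ∀ i → i ≤ n → f (n ∸ i) * g (n ∸ (n ∸ i)) ≡ g i * f (n ∸ i)
    swap i i≤n rewrite ℕ.m∸[m∸n]≡n i≤n = ℤ.*-comm (f (n ∸ i)) (g i)

  ⊛-assoc : ∀ f g h → (f ⊛ g) ⊛ h ≈ f ⊛ (g ⊛ h)
  ⊛-assoc f g h n = begin
    sumTo (λ i → sumTo (λ j → f j * g (i ∸ j)) i * h (n ∸ i)) n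
      ≡⟨ sumTo-cong n (λ i _ → sym (sumTo-*ʳ (h (n ∸ i)) (λ j → f j * g (i ∸ j)) i)) ⟩
    sumTo (λ i → sumTo (λ j → f j * g (i ∸ j) * h (n ∸ i)) i) n
      ≡⟨ sumTo-triangle (λ i j → f j * g (i ∸ j) * h (n ∸ i)) n ⟩
    sumTo (λ j → sumTo (λ l → f j * g (j ℕ.+ l ∸ j) * h (n ∸ (j ℕ.+ l))) (n ∸ j)) n
      ≡⟨ sumTo-cong n (λ j _ → sumTo-cong (n ∸ j) (λ l _ → reassoc j l)) ⟩
    sumTo (λ j → sumTo (λ l → f j * (g l * h (n ∸ j ∸ l))) (n ∸ j)) n
      ≡⟨ sumTo-cong n (λ j _ → sumTo-*ˡ (f j) (λ l → g l * h (n ∸ j ∸ l)) (n ∸ j)) ⟩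
    sumTo (λ j → f j * sumTo (λ l → g l * h (n ∸ j ∸ l)) (n ∸ j)) n ∎
    where
    open ≡-Reasoning
    reassoc : ∀ j l → f j * g (j ℕ.+ l ∸ j) * h (n ∸ (j ℕ.+ l)) ≡ f j * (g l * h (n ∸ j ∸ l))
    reassoc j l rewrite ℕ.m+n∸m≡n j l | ℕ.∸-+-assoc n j l = ℤ.*-assoc (f j) (g l) _

  ⊛-distribˡ-⊕ : ∀ f g h → f ⊛ (g ⊕ h) ≈ (f ⊛ g) ⊕ (f ⊛ h)
  ⊛-distribˡ-⊕ f g h n =
    trans (sumTo-cong n (λ i _ → ℤ.*-distribˡ-+ (f i) (g (n ∸ i)) (h (n ∸ i))))
          (sumTo-+ (λ i → f i * g (n ∸ i)) (λ i → f i * h (n ∸ i)) n)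

  ⊛-identityʳ : ∀ f → f ⊛ oneS ≈ f
  ⊛-identityʳ f zero    = ℤ.*-identityʳ (f 0)
  ⊛-identityʳ f (suc n) = begin
    sumTo (λ i → f i * oneS (suc n ∸ i)) n + f (suc n) * oneS (n ∸ n)
      ≡⟨ cong₂ _+_ (sumTo-zero _ n off-diagonal) diagonal ⟩
    + 0 + f (suc n)
      ≡⟨ ℤ.+-identityˡ _ ⟩
    f (suc n) ∎
    where
    open ≡-Reasoning
    off-diagonal : ∀ i → i ≤ n → f i * oneS (suc n ∸ i) ≡ + 0
    off-diagonal i i≤n rewrite ℕ.+-∸-assoc 1 i≤n = ℤ.*-zeroʳ (f i)
    diagonal : f (suc n) * oneS (n ∸ n) ≡ f (suc n)
    diagonal rewrite ℕ.n∸n≡0 n = ℤ.*-identityʳ (f (suc n))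

  xS-⊛ : ∀ f g n → (xS f ⊛ g) (suc n) ≡ (f ⊛ g) n
  xS-⊛ f g n = trans (sumTo-unconsˡ _ n) (ℤ.+-identityˡ _)

  powS-vanishes : ∀ b → b 0 ≡ + 0 → ∀ j n → n < j → powS b j n ≡ + 0
  powS-vanishes b b₀≡0 (suc j) n (s≤s n≤j) = sumTo-zero _ n term≡0
    where
    term≡0 : ∀ i → i ≤ n → b i * powS b j (n ∸ i) ≡ + 0
    term≡0 zero    _   rewrite b₀≡0 = refl
    term≡0 (suc i) i<n =
      trans (cong (b (suc i) *_) (powS-vanishes b b₀≡0 j (n ∸ suc i) n-i-1<j)) (ℤ.*-zeroʳ (b (suc i)))
      where
      n-i-1<j : n ∸ suc i < j
      n-i-1<j = ℕ.<-≤-trans (ℕ.∸-monoʳ-< (s≤s z≤n) i<n) n≤j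

  geoS-unfold : ∀ b → b 0 ≡ + 0 → geoS b ≈ oneS ⊕ (b ⊛ geoS b)
  geoS-unfold b b₀≡0 zero    rewrite b₀≡0 = refl
  geoS-unfold b b₀≡0 (suc n) = begin
    sumTo (λ j → powS b j (suc n)) (suc n)
      ≡⟨ trans (sumTo-unconsˡ _ n) (ℤ.+-identityˡ _) ⟩
    sumTo (λ j → sumTo (λ i → b i * powS b j (suc n ∸ i)) (suc n)) n
      ≡⟨ sym (sumTo-swap (λ i j → b i * powS b j (suc n ∸ i)) (suc n) n) ⟩
    sumTo (λ i → sumTo (λ j → b i * powS b j (suc n ∸ i)) n) (suc n)
      ≡⟨ sumTo-cong (suc n) inner ⟩
    sumTo (λ i → b i * geoS b (suc n ∸ i)) (suc n)
      ≡⟨ sym (ℤ.+-identityˡ _) ⟩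
    + 0 + sumTo (λ i → b i * geoS b (suc n ∸ i)) (suc n) ∎
    where
    open ≡-Reasoning
    inner : ∀ i → i ≤ suc n → sumTo (λ j → b i * powS b j (suc n ∸ i)) n ≡ b i * geoS b (suc n ∸ i)
    inner zero    _         rewrite b₀≡0 = sumTo-zero _ n (λ _ _ → refl)
    inner (suc i) (s≤s i≤n) =
      trans (sumTo-*ˡ (b (suc i)) (λ j → powS b j (n ∸ i)) n)
            (cong (b (suc i) *_) (sumTo-padʳ (λ j → powS b j (n ∸ i)) (ℕ.m∸n≤m n i)
                                             (λ j → powS-vanishes b b₀≡0 j (n ∸ i))))

  Even : Series → Set
  Even f = ∀ m → f (suc (double m)) ≡ + 0

  ⊛-even : ∀ f g → Even f → Even g → Even (f ⊛ g)
  ⊛-even f g f-even g-even m = sumTo-zero _ (suc (double m)) term≡0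
    where
    term≡0 : ∀ i → i ≤ suc (double m) → f i * g (suc (double m) ∸ i) ≡ + 0
    term≡0 i i≤n with parity i
    ... | inj₂ (t , refl) rewrite f-even t = ℤ.*-zeroˡ (g (suc (double m) ∸ suc (double t)))
    ... | inj₁ (t , refl) rewrite suc-double-∸ m t i≤n | g-even (m ∸ t) = ℤ.*-zeroʳ (f (double t))

  xS²-even : ∀ f → Even f → Even (xS (xS f))
  xS²-even f f-even zero    = refl
  xS²-even f f-even (suc m) = f-even m

  powS-even : ∀ b → Even b → ∀ j → Even (powS b j)
  powS-even b b-even zero    m = refl
  powS-even b b-even (suc j)   = ⊛-even b (powS b j) b-even (powS-even b b-even j)

  geoS-even : ∀ b → Even b → Even (geoS b)
  geoS-even b b-even m = sumTo-zero _ (suc (double m)) (λ j _ → powS-even b b-even j m)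

  F-even : ∀ k → Even (F k)
  F-even zero             m = refl
  F-even (suc zero)       m = refl
  F-even (suc (suc k))    m =
    trans (ℤ.+-identityˡ _)
          (⊛-even (xS (xS (F (suc k)))) (geoS (xS (xS (F k))))
                  (xS²-even _ (F-even (suc k))) (geoS-even _ (xS²-even _ (F-even k))) m)

  sumTo-double : ∀ (h : ℕ → ℤ) m → (∀ t → h (suc (double t)) ≡ + 0) →
                 sumTo h (double m) ≡ sumTo (λ t → h (double t)) m
  sumTo-double h zero    h-odd = refl
  sumTo-double h (suc m) h-odd = cong (_+ h (double (suc m))) (begin
    sumTo h (double m) + h (suc (double m))  ≡⟨ cong (_+_ (sumTo h (double m))) (h-odd m) ⟩
    sumTo h (double m) + + 0                 ≡⟨ ℤ.+-identityʳ _ ⟩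
    sumTo h (double m)                       ≡⟨ sumTo-double h m h-odd ⟩
    sumTo (λ t → h (double t)) m             ∎)
    where open ≡-Reasoning

  ⊛-at-double : ∀ f g → Even f → ∀ m →
                (f ⊛ g) (double m) ≡ sumTo (λ t → f (double t) * g (double (m ∸ t))) m
  ⊛-at-double f g f-even m =
    trans (sumTo-double _ m odd-term≡0)
          (sumTo-cong m (λ t _ → cong (λ i → f (double t) * g i) (double-∸ m t)))
    where
    odd-term≡0 : ∀ t → f (suc (double t)) * g (double m ∸ suc (double t)) ≡ + 0
    odd-term≡0 t rewrite f-even t = ℤ.*-zeroˡ (g (double m ∸ suc (double t)))

  sumBelow : (ℕ → ℤ) → ℕ → ℤ
  sumBelow h zero    = + 0
  sumBelow h (suc m) = sumBelow h m + h m

  sumTo-sumBelow : ∀ (h : ℕ → ℤ) m → sumTo h m ≡ sumBelow h m + h m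
  sumTo-sumBelow h zero    = sym (ℤ.+-identityˡ (h 0))
  sumTo-sumBelow h (suc m) = cong (_+ h (suc m)) (sumTo-sumBelow h m)

  sumBelow-cong : ∀ {h h′ : ℕ → ℤ} m → (∀ t → t < m → h t ≡ h′ t) → sumBelow h m ≡ sumBelow h′ m
  sumBelow-cong zero    h≗h′ = refl
  sumBelow-cong (suc m) h≗h′ =
    cong₂ _+_ (sumBelow-cong m (λ t t<m → h≗h′ t (ℕ.m≤n⇒m≤1+n t<m))) (h≗h′ m ℕ.≤-refl)

  F-double-suc : ∀ k m → F (suc (suc k)) (double (suc m))
               ≡ F (suc k) (double m) + sumBelow (λ t → F k (double t) * F (suc (suc k)) (double (m ∸ t))) m
  F-double-suc k m =
    trans (ℤ.+-identityˡ _) (trans (H-unfold (double (suc m))) (cong (_+_ (F (suc k) (double m))) bH≡))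
    where
    open ≡-Reasoning
    a b H : Series
    a = xS (xS (F (suc k)))
    b = xS (xS (F k))
    H = a ⊛ geoS b

    H-unfold : H ≈ a ⊕ (b ⊛ H)
    H-unfold n = begin
      H n                                  ≡⟨ ⊛-cong {a} (λ _ → refl) (geoS-unfold b refl) n ⟩
      (a ⊛ (oneS ⊕ (b ⊛ geoS b))) n        ≡⟨ ⊛-distribˡ-⊕ a oneS (b ⊛ geoS b) n ⟩
      (a ⊛ oneS) n + (a ⊛ (b ⊛ geoS b)) n  ≡⟨ cong₂ _+_ (⊛-identityʳ a n) reorder ⟩
      a n + (b ⊛ H) n                      ∎
      where
      reorder : (a ⊛ (b ⊛ geoS b)) n ≡ (b ⊛ H) n
      reorder = begin
        (a ⊛ (b ⊛ geoS b)) n   ≡⟨ sym (⊛-assoc a b (geoS b) n) ⟩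
        ((a ⊛ b) ⊛ geoS b) n   ≡⟨ ⊛-cong {a ⊛ b} {b ⊛ a} {geoS b} (⊛-comm a b) (λ _ → refl) n ⟩
        ((b ⊛ a) ⊛ geoS b) n   ≡⟨ ⊛-assoc b a (geoS b) n ⟩
        (b ⊛ H) n              ∎

    H≡F : ∀ t → t < m →
          F k (double t) * H (double (m ∸ t)) ≡ F k (double t) * F (suc (suc k)) (double (m ∸ t))
    H≡F t t<m with m ∸ t | ℕ.m<n⇒0<n∸m t<m
    ... | suc r | _ = cong (F k (double t) *_) (sym (ℤ.+-identityˡ _))

    last-term≡0 : F k (double m) * H (double (m ∸ m)) ≡ + 0
    last-term≡0 rewrite ℕ.n∸n≡0 m =
      trans (cong (F k (double m) *_) (ℤ.*-zeroˡ (geoS b 0))) (ℤ.*-zeroʳ (F k (double m)))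

    bH≡ : (b ⊛ H) (double (suc m)) ≡ sumBelow (λ t → F k (double t) * F (suc (suc k)) (double (m ∸ t))) m
    bH≡ = begin
      (b ⊛ H) (double (suc m))
        ≡⟨ trans (xS-⊛ (xS (F k)) H (suc (double m))) (xS-⊛ (F k) H (double m)) ⟩
      (F k ⊛ H) (double m)
        ≡⟨ ⊛-at-double (F k) H (F-even k) m ⟩
      sumTo (λ t → F k (double t) * H (double (m ∸ t))) m
        ≡⟨ sumTo-sumBelow _ m ⟩
      sumBelow (λ t → F k (double t) * H (double (m ∸ t))) m + F k (double m) * H (double (m ∸ m))
        ≡⟨ cong₂ _+_ (sumBelow-cong m H≡F) last-term≡0 ⟩
      sumBelow (λ t → F k (double t) * F (suc (suc k)) (double (m ∸ t))) m + + 0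
        ≡⟨ ℤ.+-identityʳ _ ⟩
      sumBelow (λ t → F k (double t) * F (suc (suc k)) (double (m ∸ t))) m ∎

module Counting where

  open import Data.Nat.Base using (_+_; _*_)

  <ᵇ-true : ∀ {m n} → m < n → (m <ᵇ n) ≡ true
  <ᵇ-true m<n = Equivalence.to T-≡ (ℕ.<⇒<ᵇ m<n)

  <ᵇ-true⁻ : ∀ {m n} → (m <ᵇ n) ≡ true → m < n
  <ᵇ-true⁻ {m} {n} m<ᵇn = ℕ.<ᵇ⇒< m n (Equivalence.from T-≡ m<ᵇn)

  <ᵇ-false : ∀ {m n} → n ≤ m → (m <ᵇ n) ≡ false
  <ᵇ-false n≤m = ¬-not (ℕ.≤⇒≯ n≤m ∘ <ᵇ-true⁻)

  +-<ᵇ : ∀ c a b → ((c + a) <ᵇ (c + b)) ≡ (a <ᵇ b)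
  +-<ᵇ zero    a b = refl
  +-<ᵇ (suc c) a b = +-<ᵇ c a b

  ≡ᵇ-true⁻ : ∀ {m n} → (m ≡ᵇ n) ≡ true → m ≡ n
  ≡ᵇ-true⁻ {m} {n} m≡ᵇn = ℕ.≡ᵇ⇒≡ m n (Equivalence.from T-≡ m≡ᵇn)

  ≡ᵇ-refl : ∀ m → (m ≡ᵇ m) ≡ true
  ≡ᵇ-refl m = Equivalence.to T-≡ (ℕ.≡⇒≡ᵇ m m refl)

  ≡ᵇ-false : ∀ {m n} → m ≢ n → (m ≡ᵇ n) ≡ false
  ≡ᵇ-false m≢n = ¬-not (m≢n ∘ ≡ᵇ-true⁻)

  ∧-true⁻ : ∀ {a b} → (a ∧ b) ≡ true → a ≡ true × b ≡ true
  ∧-true⁻ {true} b≡true = refl , b≡true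

  not-true⁻ : ∀ {b} → not b ≡ true → b ≡ false
  not-true⁻ {false} _ = refl

  ∧-not-∨-interchange : ∀ a b c d e f →
    ((a ∧ b) ∧ (not (c ∨ d) ∧ not (e ∨ f))) ≡ ((a ∧ (not c ∧ not e)) ∧ (b ∧ (not d ∧ not f)))
  ∧-not-∨-interchange false b     c     d     e     f     = refl
  ∧-not-∨-interchange true  false c     d     e     f     = sym (∧-zeroʳ _)
  ∧-not-∨-interchange true  true  true  d     e     f     = refl
  ∧-not-∨-interchange true  true  false true  e     f     = sym (∧-zeroʳ _)
  ∧-not-∨-interchange true  true  false false true  f     = refl
  ∧-not-∨-interchange true  true  false false false true  = refl
  ∧-not-∨-interchange true  true  false false false false = refl

  anyB-++ : ∀ {A : Set} (p : A → Bool) xs ys → anyB p (xs ++ ys) ≡ anyB p xs ∨ anyB p ys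
  anyB-++ p []       ys = refl
  anyB-++ p (x ∷ xs) ys rewrite anyB-++ p xs ys = sym (∨-assoc (p x) _ _)

  anyB-map : ∀ {A B : Set} (p : B → Bool) (f : A → B) xs → anyB p (map f xs) ≡ anyB (p ∘ f) xs
  anyB-map p f []       = refl
  anyB-map p f (x ∷ xs) = cong (p (f x) ∨_) (anyB-map p f xs)

  anyB-cong : ∀ {A : Set} {p q : A → Bool} xs → (∀ {x} → x ∈ xs → p x ≡ q x) → anyB p xs ≡ anyB q xs
  anyB-cong []       p≗q = refl
  anyB-cong (x ∷ xs) p≗q = cong₂ _∨_ (p≗q (here refl)) (anyB-cong xs (p≗q ∘ there))

  anyB-false : ∀ {A : Set} (p : A → Bool) xs → (∀ {x} → x ∈ xs → p x ≡ false) → anyB p xs ≡ false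
  anyB-false p []       p≗false = refl
  anyB-false p (x ∷ xs) p≗false rewrite p≗false (here refl) = anyB-false p xs (p≗false ∘ there)

  anyB-true : ∀ {A : Set} (p : A → Bool) {xs x} → x ∈ xs → p x ≡ true → anyB p xs ≡ true
  anyB-true p {y ∷ xs} (here refl) px rewrite px = refl
  anyB-true p {y ∷ xs} (there x∈) px rewrite anyB-true p x∈ px = ∨-zeroʳ (p y)

  -- Duplicate-free lists and counting

  ∉-∷-unique : ∀ {A : Set} {x : A} {xs} → x ∉ xs → Unique xs → Unique (x ∷ xs)
  ∉-∷-unique x∉xs u = ¬Any⇒All¬ _ x∉xs ∷ u

  ∈-++-middle⁻ : ∀ {A : Set} (xs : List A) {x y ys} → y ∈ xs ++ x ∷ ys → y ≢ x → y ∈ xs ++ ys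
  ∈-++-middle⁻ []       (here y≡x) y≢x = ⊥-elim (y≢x y≡x)
  ∈-++-middle⁻ []       (there y∈) y≢x = y∈
  ∈-++-middle⁻ (a ∷ xs) (here y≡a) y≢x = here y≡a
  ∈-++-middle⁻ (a ∷ xs) (there y∈) y≢x = there (∈-++-middle⁻ xs y∈ y≢x)

  ∈-++-middle⁺ : ∀ {A : Set} (xs : List A) {x y ys} → y ∈ xs ++ ys → y ∈ xs ++ x ∷ ys
  ∈-++-middle⁺ []       y∈         = there y∈
  ∈-++-middle⁺ (a ∷ xs) (here y≡a) = here y≡a
  ∈-++-middle⁺ (a ∷ xs) (there y∈) = there (∈-++-middle⁺ xs y∈)

  unique-middle⁻ : ∀ {A : Set} (xs : List A) {x ys} →
                   Unique (xs ++ x ∷ ys) → x ∉ xs ++ ys × Unique (xs ++ ys)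
  unique-middle⁻ []       (x∉ys ∷ u) = (λ x∈ys → All.lookup x∉ys x∈ys refl) , u
  unique-middle⁻ (a ∷ xs) (a∉ ∷ u) with unique-middle⁻ xs u
  ... | x∉ , u′ = x∉a∷ , All.tabulate (λ y∈ → All.lookup a∉ (∈-++-middle⁺ xs y∈)) ∷ u′
    where
    x∉a∷ : _ ∉ a ∷ xs ++ _
    x∉a∷ (here x≡a) = All.lookup a∉ (∈-++⁺ʳ xs (here refl)) (sym x≡a)
    x∉a∷ (there x∈) = x∉ x∈

  unique-middle⁺ : ∀ {A : Set} (xs : List A) {x ys} →
                   x ∉ xs ++ ys → Unique (xs ++ ys) → Unique (xs ++ x ∷ ys)
  unique-middle⁺ []       x∉ u        = ∉-∷-unique x∉ u
  unique-middle⁺ (a ∷ xs) x∉ (a∉ ∷ u) =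
    All.++⁺ (All.++⁻ˡ xs a∉) ((λ a≡x → x∉ (here (sym a≡x))) ∷ All.++⁻ʳ xs a∉)
    ∷ unique-middle⁺ xs (x∉ ∘ there) u

  unique-++⁻ : ∀ {A : Set} (xs : List A) {ys} → Unique (xs ++ ys) → Unique xs × Unique ys
  unique-++⁻ []       u          = [] , u
  unique-++⁻ (x ∷ xs) (x∉ ∷ u) = let uxs , uys = unique-++⁻ xs u in All.++⁻ˡ xs x∉ ∷ uxs , uys

  unique-++-disjoint : ∀ {A : Set} (xs : List A) {ys x y} → Unique (xs ++ ys) → x ∈ xs → y ∈ ys → x ≢ y
  unique-++-disjoint (a ∷ xs) (a∉ ∷ u) (here refl) y∈ys = All.lookup a∉ (∈-++⁺ʳ xs y∈ys)
  unique-++-disjoint (a ∷ xs) (a∉ ∷ u) (there x∈) y∈ys = unique-++-disjoint xs u x∈ y∈ys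

  length-++-middle : ∀ {A : Set} (xs : List A) {x ys} → length (xs ++ x ∷ ys) ≡ suc (length (xs ++ ys))
  length-++-middle xs {x} {ys} rewrite List.length-++ xs {x ∷ ys} | List.length-++ xs {ys} =
    ℕ.+-suc (length xs) (length ys)

  unique-⊆⇒length≤ : ∀ {A : Set} {w S : List A} → Unique w → w ⊆ S → length w ≤ length S
  unique-⊆⇒length≤ {w = []}    _           _    = z≤n
  unique-⊆⇒length≤ {w = a ∷ w} (a∉w ∷ u) w⊆S with ∈-∃++ (w⊆S (here refl))
  ... | S₁ , S₂ , refl =
    subst (suc (length w) ≤_) (sym (length-++-middle S₁))
          (s≤s (unique-⊆⇒length≤ u λ b∈w →
                  ∈-++-middle⁻ S₁ (w⊆S (there b∈w)) (λ { refl → All.lookup a∉w b∈w refl })))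

  unique-⊆-missing⇒length< : ∀ {A : Set} {w S : List A} {v} →
                             Unique w → w ⊆ S → v ∈ S → v ∉ w → length w < length S
  unique-⊆-missing⇒length< {w = w} u w⊆S v∈S v∉w with ∈-∃++ v∈S
  ... | S₁ , S₂ , refl =
    subst (suc (length w) ≤_) (sym (length-++-middle S₁))
          (s≤s (unique-⊆⇒length≤ u (λ b∈w → ∈-++-middle⁻ S₁ (w⊆S b∈w) (λ { refl → v∉w b∈w }))))

  countB-++ : ∀ {A : Set} (p : A → Bool) xs ys → countB p (xs ++ ys) ≡ countB p xs + countB p ys
  countB-++ p []       ys = refl
  countB-++ p (x ∷ xs) ys with p x
  ... | true  = cong suc (countB-++ p xs ys)
  ... | false = countB-++ p xs ys

  countB-cong : ∀ {A : Set} {p q : A → Bool} xs → (∀ {x} → x ∈ xs → p x ≡ q x) → countB p xs ≡ countB q xs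
  countB-cong                 []       p≗q = refl
  countB-cong {p = p} {q} (x ∷ xs) p≗q rewrite p≗q (here refl) with q x
  ... | true  = cong suc (countB-cong xs (p≗q ∘ there))
  ... | false = countB-cong xs (p≗q ∘ there)

  countB-map : ∀ {A B : Set} (q : B → Bool) (f : A → B) xs → countB q (map f xs) ≡ countB (λ x → q (f x)) xs
  countB-map q f []       = refl
  countB-map q f (x ∷ xs) with q (f x)
  ... | true  = cong suc (countB-map q f xs)
  ... | false = countB-map q f xs

  countB-false : ∀ {A : Set} (p : A → Bool) xs → (∀ {x} → x ∈ xs → p x ≡ false) → countB p xs ≡ 0
  countB-false p []       p≗false = refl
  countB-false p (x ∷ xs) p≗false rewrite p≗false (here refl) = countB-false p xs (p≗false ∘ there)

  countB-cartesianProduct : ∀ {A B : Set} (r : A × B → Bool) (p : A → Bool) (q : B → Bool) xs ys →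
    (∀ {a b} → a ∈ xs → b ∈ ys → r (a , b) ≡ (p a ∧ q b)) →
    countB r (cartesianProduct xs ys) ≡ countB p xs * countB q ys
  countB-cartesianProduct r p q []       ys r≗p∧q = refl
  countB-cartesianProduct r p q (a ∷ xs) ys r≗p∧q = begin
    countB r (map (a ,_) ys ++ cartesianProduct xs ys)
      ≡⟨ countB-++ r (map (a ,_) ys) (cartesianProduct xs ys) ⟩
    countB r (map (a ,_) ys) + countB r (cartesianProduct xs ys)
      ≡⟨ cong₂ _+_ (trans (countB-map r (a ,_) ys) (countB-cong ys (r≗p∧q (here refl))))
                   (countB-cartesianProduct r p q xs ys (r≗p∧q ∘ there)) ⟩
    countB (λ b → p a ∧ q b) ys + countB p xs * countB q ys
      ≡⟨ first-row (p a) ⟩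
    countB p (a ∷ xs) * countB q ys ∎
    where
    open ≡-Reasoning
    first-row : ∀ pa → countB (λ b → pa ∧ q b) ys + countB p xs * countB q ys
                     ≡ (if pa then suc (countB p xs) else countB p xs) * countB q ys
    first-row true  = refl
    first-row false = cong (_+ countB p xs * countB q ys) (countB-false (λ _ → false) ys (λ _ → refl))

  countB-middle : ∀ {A : Set} (p : A → Bool) xs {x} ys → p x ≡ true →
                  countB p (xs ++ x ∷ ys) ≡ suc (countB p (xs ++ ys))
  countB-middle p xs {x} ys px≡true
    rewrite countB-++ p xs (x ∷ ys) | countB-++ p xs ys | px≡true = ℕ.+-suc _ _

  countB-bijection : ∀ {A B : Set} (p : A → Bool) (q : B → Bool) (f : A → B) (g : B → A) xs ys →
    Unique xs → Unique ys →
    (∀ {x} → x ∈ xs → p x ≡ true → f x ∈ ys × q (f x) ≡ true × g (f x) ≡ x) →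
    (∀ {y} → y ∈ ys → q y ≡ true → g y ∈ xs × p (g y) ≡ true × f (g y) ≡ y) →
    countB p xs ≡ countB q ys
  countB-bijection p q f g [] ys _ _ _ to-xs =
    sym (countB-false q ys (λ {y} y∈ys → ¬-not (λ qy≡true → ∉[] (proj₁ (to-xs y∈ys qy≡true)))))
  countB-bijection p q f g (x ∷ xs) ys (x∉xs ∷ xs-unique) ys-unique to-ys to-xs with p x in px
  ... | true with to-ys (here refl) px
  ... | fx∈ys , qfx , gfx≡x with ∈-∃++ fx∈ys
  ... | ys₁ , ys₂ , refl with unique-middle⁻ ys₁ ys-unique
  ... | fx∉ , ys₁₂-unique =
    trans (cong suc (countB-bijection p q f g xs (ys₁ ++ ys₂) xs-unique ys₁₂-unique to-ys′ to-xs′))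
          (sym (countB-middle q ys₁ ys₂ qfx))
    where
    to-ys′ : ∀ {x′} → x′ ∈ xs → p x′ ≡ true →
             f x′ ∈ ys₁ ++ ys₂ × q (f x′) ≡ true × g (f x′) ≡ x′
    to-ys′ x′∈xs px′ with to-ys (there x′∈xs) px′
    ... | fx′∈ , qfx′ , gfx′ = ∈-++-middle⁻ ys₁ fx′∈ fx′≢fx , qfx′ , gfx′
      where
      fx′≢fx : f _ ≢ f x
      fx′≢fx fx′≡fx = All.lookup x∉xs x′∈xs (trans (sym gfx≡x) (trans (cong g (sym fx′≡fx)) gfx′))
    to-xs′ : ∀ {y} → y ∈ ys₁ ++ ys₂ → q y ≡ true → g y ∈ xs × p (g y) ≡ true × f (g y) ≡ y
    to-xs′ y∈ qy with to-xs (∈-++-middle⁺ ys₁ y∈) qy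
    ... | here gy≡x , _ , fgy = ⊥-elim (fx∉ (subst (_∈ ys₁ ++ ys₂) (trans (sym fgy) (cong f gy≡x)) y∈))
    ... | there gy∈ , pgy , fgy = gy∈ , pgy , fgy
  countB-bijection p q f g (x ∷ xs) ys (_ ∷ xs-unique) ys-unique to-ys to-xs | false =
    countB-bijection p q f g xs ys xs-unique ys-unique (to-ys ∘ there) to-xs′
    where
    to-xs′ : ∀ {y} → y ∈ ys → q y ≡ true → g y ∈ xs × p (g y) ≡ true × f (g y) ≡ y
    to-xs′ y∈ qy with to-xs y∈ qy
    ... | here gy≡x , pgy , _ with () ← trans (sym pgy) (trans (cong p gy≡x) px)
    ... | there gy∈ , pgy , fgy = gy∈ , pgy , fgy

  sumBelowℕ : (ℕ → ℕ) → ℕ → ℕ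
  sumBelowℕ h zero    = 0
  sumBelowℕ h (suc m) = sumBelowℕ h m + h m

  sumBelowℕ-cong : ∀ {h h′ : ℕ → ℕ} m → (∀ {t} → t < m → h t ≡ h′ t) →
                   sumBelowℕ h m ≡ sumBelowℕ h′ m
  sumBelowℕ-cong zero    h≗h′ = refl
  sumBelowℕ-cong (suc m) h≗h′ =
    cong₂ _+_ (sumBelowℕ-cong m (h≗h′ ∘ ℕ.m≤n⇒m≤1+n)) (h≗h′ ℕ.≤-refl)

  sumBelowℕ-zero : ∀ (h : ℕ → ℕ) m → (∀ t → h t ≡ 0) → sumBelowℕ h m ≡ 0
  sumBelowℕ-zero h zero    h≗0 = refl
  sumBelowℕ-zero h (suc m) h≗0 = cong₂ _+_ (sumBelowℕ-zero h m h≗0) (h≗0 m)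

  -- Permutations of [n]

  elemB⇒∈ : ∀ a w → elemB a w ≡ true → a ∈ w
  elemB⇒∈ a (b ∷ w) a∈w with a ≡ᵇ b in a≡ᵇb
  ... | true  = here (≡ᵇ-true⁻ a≡ᵇb)
  ... | false = there (elemB⇒∈ a w a∈w)

  ∈⇒elemB : ∀ {a w} → a ∈ w → elemB a w ≡ true
  ∈⇒elemB {a} (here refl) rewrite ≡ᵇ-refl a = refl
  ∈⇒elemB {a} {b ∷ w} (there a∈w) rewrite ∈⇒elemB a∈w = ∨-zeroʳ (a ≡ᵇ b)

  distinct⇒unique : ∀ w → distinct w ≡ true → Unique w
  distinct⇒unique []      _ = []
  distinct⇒unique (a ∷ w) d with elemB a w in a∈?w
  distinct⇒unique (a ∷ w) () | true
  ... | false = ∉-∷-unique (λ a∈w → case trans (sym (∈⇒elemB a∈w)) a∈?w of λ ()) (distinct⇒unique w d)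

  unique⇒distinct : ∀ {w} → Unique w → distinct w ≡ true
  unique⇒distinct                []         = refl
  unique⇒distinct {a ∷ w} (a∉w ∷ u) with elemB a w in a∈?w
  ... | true  = ⊥-elim (All.lookup a∉w (elemB⇒∈ a w a∈?w) refl)
  ... | false = unique⇒distinct u

  ∈-filterB⁻ : ∀ {A : Set} (p : A → Bool) xs {x} → x ∈ filterB p xs → x ∈ xs × p x ≡ true
  ∈-filterB⁻ p (y ∷ xs) x∈ with p y in py | x∈
  ... | true  | here refl = here refl , py
  ... | true  | there x∈′ = let x∈xs , px = ∈-filterB⁻ p xs x∈′ in there x∈xs , px
  ... | false | x∈′       = let x∈xs , px = ∈-filterB⁻ p xs x∈′ in there x∈xs , px

  ∈-filterB⁺ : ∀ {A : Set} (p : A → Bool) {xs x} → x ∈ xs → p x ≡ true → x ∈ filterB p xs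
  ∈-filterB⁺ p {y ∷ xs} (here refl) px rewrite px = here refl
  ∈-filterB⁺ p {y ∷ xs} (there x∈) px with p y
  ... | true  = there (∈-filterB⁺ p x∈ px)
  ... | false = ∈-filterB⁺ p x∈ px

  filterB-unique : ∀ {A : Set} (p : A → Bool) {xs} → Unique xs → Unique (filterB p xs)
  filterB-unique p []                   = []
  filterB-unique p {x ∷ xs} (x∉xs ∷ u) with p x
  ... | true  = All.tabulate (λ y∈ → All.lookup x∉xs (proj₁ (∈-filterB⁻ p xs y∈))) ∷ filterB-unique p u
  ... | false = filterB-unique p u

  concatMap-∷≡cartesianProduct : ∀ (al : List ℕ) (L : List (List ℕ)) →
                                 concatMap (λ a → map (a ∷_) L) al ≡ cartesianProductWith _∷_ al L
  concatMap-∷≡cartesianProduct []       L = refl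
  concatMap-∷≡cartesianProduct (a ∷ al) L = cong (map (a ∷_) L ++_) (concatMap-∷≡cartesianProduct al L)

  words-suc : ∀ n al → words (suc n) al ≡ cartesianProductWith _∷_ al (words n al)
  words-suc n al = concatMap-∷≡cartesianProduct al (words n al)

  ∈-words⁻ : ∀ n al {w} → w ∈ words n al → length w ≡ n × w ⊆ al
  ∈-words⁻ zero    al (here refl) = refl , λ ()
  ∈-words⁻ (suc n) al w∈
    with ∈-cartesianProductWith⁻ _∷_ al (words n al) (subst (_ ∈_) (words-suc n al) w∈)
  ... | a , w′ , a∈al , w′∈ , refl =
    let |w′|≡n , w′⊆al = ∈-words⁻ n al w′∈
    in cong suc |w′|≡n , λ { (here refl) → a∈al ; (there b∈w′) → w′⊆al b∈w′ }

  ∈-words⁺ : ∀ al w → w ⊆ al → w ∈ words (length w) al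
  ∈-words⁺ al []      _    = here refl
  ∈-words⁺ al (a ∷ w) w⊆al =
    subst (_ ∈_) (sym (words-suc (length w) al))
          (∈-cartesianProductWith⁺ _∷_ (w⊆al (here refl)) (∈-words⁺ al w (w⊆al ∘ there)))

  words-unique : ∀ n {al} → Unique al → Unique (words n al)
  words-unique zero    _         = [] ∷ []
  words-unique (suc n) {al} al-u =
    subst Unique (sym (words-suc n al))
          (Unique.cartesianProductWith⁺ _∷_ List.∷-injective al-u (words-unique n al-u))

  ∈-oneTo⁻ : ∀ n {a} → a ∈ oneTo n → 0 < a × a ≤ n
  ∈-oneTo⁻ n a∈ with ∈-map⁻ suc a∈
  ... | i , i∈ , refl = s≤s z≤n , ∈-upTo⁻ i∈

  ∈-oneTo⁺ : ∀ n {a} → 0 < a → a ≤ n → a ∈ oneTo n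
  ∈-oneTo⁺ n {suc a} _ a<n = ∈-map⁺ suc (∈-upTo⁺ a<n)

  oneTo-unique : ∀ n → Unique (oneTo n)
  oneTo-unique n = Unique.map⁺ ℕ.suc-injective (Unique.upTo⁺ n)

  record IsPerm (n : ℕ) (w : List ℕ) : Set where
    field
      length≡ : length w ≡ n
      unique  : Unique w
      bounded : ∀ {a} → a ∈ w → 0 < a × a ≤ n

  ∈-perms⁻ : ∀ n {w} → w ∈ perms n → IsPerm n w
  ∈-perms⁻ n {w} w∈ with ∈-filterB⁻ distinct (words n (oneTo n)) w∈
  ... | w∈words , d with ∈-words⁻ n (oneTo n) w∈words
  ... | |w|≡n , w⊆ = record { length≡ = |w|≡n ; unique = distinct⇒unique w d ; bounded = ∈-oneTo⁻ n ∘ w⊆ }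

  ∈-perms⁺ : ∀ n {w} → IsPerm n w → w ∈ perms n
  ∈-perms⁺ n {w} π =
    ∈-filterB⁺ distinct (subst (λ l → w ∈ words l (oneTo n)) length≡ (∈-words⁺ (oneTo n) w w⊆))
                        (unique⇒distinct unique)
    where
    open IsPerm π
    w⊆ : w ⊆ oneTo n
    w⊆ a∈ = let 0<a , a≤n = bounded a∈ in ∈-oneTo⁺ n 0<a a≤n

  perms-unique : ∀ n → Unique (perms n)
  perms-unique n = filterB-unique distinct (words-unique n (oneTo-unique n))

  interval : ℕ → ℕ → List ℕ
  interval lo = applyUpTo (λ i → suc (lo + i))

  ∈-interval⁺ : ∀ {lo l a} → lo < a → a ≤ lo + l → a ∈ interval lo l
  ∈-interval⁺ {lo} {l} {a} lo<a a≤lo+l =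
    subst (_∈ interval lo l) a≡ (∈-applyUpTo⁺ (λ i → suc (lo + i)) i<l)
    where
    a≡ : suc (lo + (a ∸ suc lo)) ≡ a
    a≡ = ℕ.m+[n∸m]≡n lo<a
    i<l : a ∸ suc lo < l
    i<l = ℕ.+-cancelˡ-≤ lo _ _ (subst (_≤ lo + l) (trans (sym a≡) (sym (ℕ.+-suc lo _))) a≤lo+l)

  Bounded : ℕ → ℕ → List ℕ → Set
  Bounded lo l w = ∀ {a} → a ∈ w → lo < a × a ≤ lo + l

  Bounded⇒⊆interval : ∀ {lo l w} → Bounded lo l w → w ⊆ interval lo l
  Bounded⇒⊆interval bounded a∈ = let lo<a , a≤ = bounded a∈ in ∈-interval⁺ lo<a a≤

  bounded-unique-length≤ : ∀ {lo l w} → Unique w → Bounded lo l w → length w ≤ l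
  bounded-unique-length≤ {lo} {l} u bounded =
    subst (_ ≤_) (List.length-applyUpTo _ l) (unique-⊆⇒length≤ u (Bounded⇒⊆interval bounded))

  bounded-unique-full : ∀ {lo l w v} → Unique w → Bounded lo l w → length w ≡ l →
                        lo < v → v ≤ lo + l → v ∈ w
  bounded-unique-full {lo} {l} {w} {v} u bounded |w|≡l lo<v v≤ with v ∈? w
  ... | yes v∈w = v∈w
  ... | no  v∉w = ⊥-elim (ℕ.<-irrefl |w|≡l (subst (length w <_) (List.length-applyUpTo _ l)
                    (unique-⊆-missing⇒length< u (Bounded⇒⊆interval bounded) (∈-interval⁺ lo<v v≤) v∉w)))

  IsPerm-∋ : ∀ {n w v} → IsPerm n w → 0 < v → v ≤ n → v ∈ w
  IsPerm-∋ π = bounded-unique-full unique bounded length≡ where open IsPerm π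

  IsPerm⇒<suc : ∀ {n w} → IsPerm n w → All (_< suc n) w
  IsPerm⇒<suc π = All.tabulate (s≤s ∘ proj₂ ∘ IsPerm.bounded π)

  IsPerm-insert-max : ∀ {n} xs {ys} → IsPerm n (xs ++ ys) → IsPerm (suc n) (xs ++ suc n ∷ ys)
  IsPerm-insert-max {n} xs {ys} π = record
    { length≡ = trans (length-++-middle xs) (cong suc length≡)
    ; unique  = unique-middle⁺ xs (λ n+1∈ → ℕ.<-irrefl refl (All.lookup (IsPerm⇒<suc π) n+1∈)) unique
    ; bounded = bounded′
    }
    where
    open IsPerm π
    bounded′ : ∀ {a} → a ∈ xs ++ suc n ∷ ys → 0 < a × a ≤ suc n
    bounded′ {a} a∈ with a ≟ suc n
    ... | yes refl = s≤s z≤n , ℕ.≤-refl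
    ... | no  a≢   = let 0<a , a≤n = bounded (∈-++-middle⁻ xs a∈ a≢) in 0<a , ℕ.m≤n⇒m≤1+n a≤n

  IsPerm-∷ʳ : ∀ {n} α → IsPerm n α → IsPerm (suc n) (α ++ suc n ∷ [])
  IsPerm-∷ʳ {n} α π = IsPerm-insert-max α (subst (IsPerm n) (sym (List.++-identityʳ α)) π)

  IsPerm-remove-max : ∀ {n} xs {ys} → IsPerm (suc n) (xs ++ suc n ∷ ys) → IsPerm n (xs ++ ys)
  IsPerm-remove-max {n} xs {ys} π = record
    { length≡ = ℕ.suc-injective (trans (sym (length-++-middle xs)) length≡)
    ; unique  = proj₂ (unique-middle⁻ xs unique)
    ; bounded = bounded′
    }
    where
    open IsPerm π
    bounded′ : ∀ {a} → a ∈ xs ++ ys → 0 < a × a ≤ n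
    bounded′ a∈ with bounded (∈-++-middle⁺ xs a∈)
    ... | 0<a , a≤n+1 =
      0<a , ℕ.≤-pred (ℕ.≤∧≢⇒< a≤n+1 (λ { refl → proj₁ (unique-middle⁻ xs unique) a∈ }))

  map-+-∸ : ∀ j γ → All (j ≤_) γ → map (j +_) (map (_∸ j) γ) ≡ γ
  map-+-∸ j []      []           = refl
  map-+-∸ j (a ∷ γ) (j≤a ∷ j≤γ) = cong₂ _∷_ (ℕ.m+[n∸m]≡n j≤a) (map-+-∸ j γ j≤γ)

  map-∸-+ : ∀ j α → map (_∸ j) (map (j +_) α) ≡ α
  map-∸-+ j []      = refl
  map-∸-+ j (a ∷ α) = cong₂ _∷_ (ℕ.m+n∸m≡n j a) (map-∸-+ j α)

  IsPerm-shift-++ : ∀ {g j α β} → IsPerm g α → IsPerm j β → IsPerm (g + j) (map (j +_) α ++ β)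
  IsPerm-shift-++ {g} {j} {α} {β} α-perm β-perm = record
    { length≡ = trans (List.length-++ (map (j +_) α))
                      (cong₂ _+_ (trans (List.length-map (j +_) α) (IsPerm.length≡ α-perm)) (IsPerm.length≡ β-perm))
    ; unique  = Unique.++⁺ (Unique.map⁺ (ℕ.+-cancelˡ-≡ j _ _) (IsPerm.unique α-perm)) (IsPerm.unique β-perm) disjoint
    ; bounded = bounded′
    }
    where
    disjoint : ∀ {v} → v ∈ map (j +_) α × v ∈ β → ⊥
    disjoint (v∈ , v∈β) with ∈-map⁻ (j +_) v∈
    ... | a , a∈α , refl =
      ℕ.<⇒≱ (ℕ.m<m+n j (proj₁ (IsPerm.bounded α-perm a∈α))) (proj₂ (IsPerm.bounded β-perm v∈β))
    bounded′ : ∀ {v} → v ∈ map (j +_) α ++ β → 0 < v × v ≤ g + j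
    bounded′ v∈ with ∈-++⁻ (map (j +_) α) v∈
    ... | inj₂ v∈β = let 0<v , v≤j = IsPerm.bounded β-perm v∈β in 0<v , ℕ.≤-trans v≤j (ℕ.m≤n+m j g)
    ... | inj₁ v∈ with ∈-map⁻ (j +_) v∈
    ... | a , a∈α , refl = let 0<a , a≤g = IsPerm.bounded α-perm a∈α in
      ℕ.<-≤-trans 0<a (ℕ.m≤n+m a j) , subst (j + a ≤_) (ℕ.+-comm j g) (ℕ.+-monoʳ-≤ j a≤g)

  Above : List ℕ → List ℕ → Set
  Above x y = All (λ a → All (_< a) y) x

  IsPerm-++-above : ∀ {n} γ β → IsPerm n (γ ++ β) → Above γ β →
    All (length β <_) γ × IsPerm (length β) β × IsPerm (length γ) (map (_∸ length β) γ)
  IsPerm-++-above {n} γ β π γ-above-β = γ-above , β-perm , γ-perm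
    where
    open IsPerm π
    j = length β
    g = length γ
    n≡g+j : n ≡ g + j
    n≡g+j = trans (sym length≡) (List.length-++ γ)
    γ-unique = proj₁ (unique-++⁻ γ unique)
    β-unique = proj₂ (unique-++⁻ γ unique)
    β-bounded : ∀ {b} → b ∈ β → 0 < b × b ≤ j
    β-bounded {b} b∈β = 0<b , ℕ.+-cancelˡ-≤ g b j (begin
      g + b      ≤⟨ ℕ.+-monoˡ-≤ b g≤n∸b ⟩
      n ∸ b + b  ≡⟨ ℕ.m∸n+n≡m b≤n ⟩
      n          ≡⟨ n≡g+j ⟩
      g + j      ∎)
      where
      open ℕ.≤-Reasoning
      0<b = proj₁ (bounded (∈-++⁺ʳ γ b∈β))
      b≤n = proj₂ (bounded (∈-++⁺ʳ γ b∈β))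
      γ-in-range : Bounded b (n ∸ b) γ
      γ-in-range a∈γ = All.lookup (All.lookup γ-above-β a∈γ) b∈β ,
                       subst (_ ≤_) (sym (ℕ.m+[n∸m]≡n b≤n)) (proj₂ (bounded (∈-++⁺ˡ a∈γ)))
      g≤n∸b : g ≤ n ∸ b
      g≤n∸b = bounded-unique-length≤ γ-unique γ-in-range
    γ-above : All (j <_) γ
    γ-above = All.tabulate above
      where
      above : ∀ {a} → a ∈ γ → j < a
      above a∈γ with bounded (∈-++⁺ˡ a∈γ)
      ... | s≤s {n = a′} z≤n , _ = s≤s (bounded-unique-length≤ β-unique β-in-range)
        where
        β-in-range : Bounded 0 a′ β
        β-in-range b∈β = proj₁ (β-bounded b∈β) , ℕ.≤-pred (All.lookup (All.lookup γ-above-β a∈γ) b∈β)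
    β-perm : IsPerm j β
    β-perm = record { length≡ = refl ; unique = β-unique ; bounded = β-bounded }
    γ-perm : IsPerm g (map (_∸ j) γ)
    γ-perm = record
      { length≡ = List.length-map (_∸ j) γ
      ; unique  = Unique.map⁻ (subst Unique (sym (map-+-∸ j γ (All.map ℕ.<⇒≤ γ-above))) γ-unique)
      ; bounded = bounded′
      }
      where
      bounded′ : ∀ {v} → v ∈ map (_∸ j) γ → 0 < v × v ≤ g
      bounded′ v∈ with ∈-map⁻ (_∸ j) v∈
      ... | a , a∈γ , refl =
        ℕ.m<n⇒0<n∸m (All.lookup γ-above a∈γ) ,
        ℕ.m≤n+o⇒m∸n≤o _ j (subst (_ ≤_) (trans n≡g+j (ℕ.+-comm g j)) (proj₂ (bounded (∈-++⁺ˡ a∈γ))))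

  -- Pattern containment

  allAbove : ℕ → List ℕ → Bool
  allAbove b []      = true
  allAbove b (a ∷ s) = (b <ᵇ a) ∧ allAbove b s

  increasing : List ℕ → Bool
  increasing []      = true
  increasing (a ∷ s) = allAbove a s ∧ increasing s

  hasIncAbove : ℕ → ℕ → List ℕ → Bool
  hasIncAbove b zero    w       = true
  hasIncAbove b (suc k) []      = false
  hasIncAbove b (suc k) (a ∷ w) = ((b <ᵇ a) ∧ hasIncAbove a k w) ∨ hasIncAbove b (suc k) w

  hasInc : ℕ → List ℕ → Bool
  hasInc zero    w       = true
  hasInc (suc k) []      = false
  hasInc (suc k) (a ∷ w) = hasIncAbove a k w ∨ hasInc (suc k) w

  has32Above : ℕ → List ℕ → Bool
  has32Above a []      = false
  has32Above a (b ∷ w) = ((a <ᵇ b) ∧ anyB (λ c → (a <ᵇ c) ∧ not (b <ᵇ c)) w) ∨ has32Above a w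

  has132 : List ℕ → Bool
  has132 []      = false
  has132 (a ∷ w) = has32Above a w ∨ has132 w

  sameOrd-suc : ∀ a b s t → sameOrd a (suc b) s (map suc t) ≡ sameOrd a b s t
  sameOrd-suc a b []      []      = refl
  sameOrd-suc a b []      (_ ∷ _) = refl
  sameOrd-suc a b (_ ∷ _) []      = refl
  sameOrd-suc a b (c ∷ s) (d ∷ t) = cong (beq (a <ᵇ c) (b <ᵇ d) ∧_) (sameOrd-suc a b s t)

  orderIso-suc : ∀ s t → orderIso s (map suc t) ≡ orderIso s t
  orderIso-suc []      []      = refl
  orderIso-suc []      (_ ∷ _) = refl
  orderIso-suc (_ ∷ _) []      = refl
  orderIso-suc (a ∷ s) (b ∷ t) = cong₂ _∧_ (sameOrd-suc a b s t) (orderIso-suc s t)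

  sameOrd-1 : ∀ a s u → length s ≡ length u → sameOrd a 1 s (map suc (map suc u)) ≡ allAbove a s
  sameOrd-1 a []      []      _    = refl
  sameOrd-1 a (c ∷ s) (d ∷ u) |s|≡ = cong₂ _∧_ (beq-true (a <ᵇ c)) (sameOrd-1 a s u (ℕ.suc-injective |s|≡))
    where
    beq-true : ∀ x → beq x true ≡ x
    beq-true true  = refl
    beq-true false = refl

  oneTo-suc : ∀ k → oneTo (suc k) ≡ 1 ∷ map suc (oneTo k)
  oneTo-suc k = cong (λ l → 1 ∷ map suc l) (sym (List.map-upTo suc k))

  orderIso-incPat : ∀ s k → length s ≡ k → orderIso s (incPat k) ≡ increasing s
  orderIso-incPat []      zero    _    = refl
  orderIso-incPat (a ∷ s) (suc k) |s|≡ = trans (cong (orderIso (a ∷ s)) (oneTo-suc k))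
    (cong₂ _∧_ (sameOrd-1 a s (upTo k) (trans (ℕ.suc-injective |s|≡) (sym (List.length-upTo k))))
               (trans (orderIso-suc s (oneTo k)) (orderIso-incPat s k (ℕ.suc-injective |s|≡))))

  length-subseqs : ∀ k w {s} → s ∈ subseqs k w → length s ≡ k
  length-subseqs zero    w       (here refl) = refl
  length-subseqs (suc k) (a ∷ w) s∈ with ∈-++⁻ (map (a ∷_) (subseqs k w)) s∈
  ... | inj₂ s∈′ = length-subseqs (suc k) w s∈′
  ... | inj₁ s∈′ with ∈-map⁻ (a ∷_) s∈′
  ... | s′ , s′∈ , refl = cong suc (length-subseqs k w s′∈)

  allAbove-weaken : ∀ b a s → b < a → allAbove a s ≡ true → allAbove b s ≡ true
  allAbove-weaken b a []      b<a _         = refl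
  allAbove-weaken b a (c ∷ s) b<a all-above with a <ᵇ c in a<ᵇc
  ... | true = cong₂ _∧_ (<ᵇ-true (ℕ.<-trans b<a (<ᵇ-true⁻ {a} {c} a<ᵇc))) (allAbove-weaken b a s b<a all-above)

  anyB-increasingAbove : ∀ b k w → anyB (λ s → allAbove b s ∧ increasing s) (subseqs k w) ≡ hasIncAbove b k w
  anyB-increasingAbove b zero    w       = refl
  anyB-increasingAbove b (suc k) []      = refl
  anyB-increasingAbove b (suc k) (a ∷ w) = begin
    anyB P (map (a ∷_) (subseqs k w) ++ subseqs (suc k) w)
      ≡⟨ anyB-++ P (map (a ∷_) (subseqs k w)) _ ⟩
    anyB P (map (a ∷_) (subseqs k w)) ∨ anyB P (subseqs (suc k) w)
      ≡⟨ cong₂ _∨_ (trans (anyB-map P (a ∷_) (subseqs k w)) starting-with-a) (anyB-increasingAbove b (suc k) w) ⟩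
    ((b <ᵇ a) ∧ hasIncAbove a k w) ∨ hasIncAbove b (suc k) w ∎
    where
    open ≡-Reasoning
    P : List ℕ → Bool
    P s = allAbove b s ∧ increasing s
    starting-with-a : anyB (λ s → P (a ∷ s)) (subseqs k w) ≡ ((b <ᵇ a) ∧ hasIncAbove a k w)
    starting-with-a with b <ᵇ a in b<ᵇa
    ... | false = anyB-false _ (subseqs k w) (λ _ → refl)
    ... | true  = trans (anyB-cong (subseqs k w) (λ {s} _ → absorb s)) (anyB-increasingAbove a k w)
      where
      absorb : ∀ s → (allAbove b s ∧ (allAbove a s ∧ increasing s)) ≡ (allAbove a s ∧ increasing s)
      absorb s with allAbove a s in above-a
      ... | false = ∧-zeroʳ _
      ... | true rewrite allAbove-weaken b a s (<ᵇ-true⁻ {b} {a} b<ᵇa) above-a = refl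

  anyB-increasing : ∀ k w → anyB increasing (subseqs k w) ≡ hasInc k w
  anyB-increasing zero    w       = refl
  anyB-increasing (suc k) []      = refl
  anyB-increasing (suc k) (a ∷ w) =
    trans (anyB-++ increasing (map (a ∷_) (subseqs k w)) _)
          (cong₂ _∨_ (trans (anyB-map increasing (a ∷_) (subseqs k w)) (anyB-increasingAbove a k w))
                     (anyB-increasing (suc k) w))

  contains-incPat : ∀ k w → contains (incPat k) w ≡ hasInc k w
  contains-incPat k w rewrite List.length-map suc (upTo k) | List.length-upTo k =
    trans (anyB-cong (subseqs k w) (λ {s} s∈ → orderIso-incPat s k (length-subseqs k w s∈))) (anyB-increasing k w)

  orderIso-132 : ∀ x y z → orderIso (x ∷ y ∷ z ∷ []) pat132 ≡ ((x <ᵇ y) ∧ ((x <ᵇ z) ∧ not (y <ᵇ z)))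
  orderIso-132 x y z with x <ᵇ y | x <ᵇ z | y <ᵇ z
  ... | true  | true  | true  = refl
  ... | true  | true  | false = refl
  ... | true  | false | true  = refl
  ... | true  | false | false = refl
  ... | false | true  | true  = refl
  ... | false | true  | false = refl
  ... | false | false | true  = refl
  ... | false | false | false = refl

  anyB-subseqs-1 : ∀ (P : List ℕ → Bool) w → anyB P (subseqs 1 w) ≡ anyB (λ c → P (c ∷ [])) w
  anyB-subseqs-1 P []      = refl
  anyB-subseqs-1 P (c ∷ w) = cong (P (c ∷ []) ∨_) (anyB-subseqs-1 P w)

  anyB-132-starting-with : ∀ x w → anyB (λ s → orderIso (x ∷ s) pat132) (subseqs 2 w) ≡ has32Above x w
  anyB-132-starting-with x []      = refl
  anyB-132-starting-with x (y ∷ w) =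
    trans (anyB-++ (λ s → orderIso (x ∷ s) pat132) (map (y ∷_) (subseqs 1 w)) _)
          (cong₂ _∨_ (trans (anyB-map (λ s → orderIso (x ∷ s) pat132) (y ∷_) (subseqs 1 w))
                     (trans (anyB-subseqs-1 (λ s → orderIso (x ∷ y ∷ s) pat132) w)
                     (trans (anyB-cong w (λ {c} _ → orderIso-132 x y c)) factor)))
                     (anyB-132-starting-with x w))
    where
    factor : anyB (λ c → (x <ᵇ y) ∧ ((x <ᵇ c) ∧ not (y <ᵇ c))) w
           ≡ ((x <ᵇ y) ∧ anyB (λ c → (x <ᵇ c) ∧ not (y <ᵇ c)) w)
    factor with x <ᵇ y
    ... | true  = refl
    ... | false = anyB-false _ w (λ _ → refl)

  contains-132 : ∀ w → contains pat132 w ≡ has132 w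
  contains-132 []      = refl
  contains-132 (x ∷ w) =
    trans (anyB-++ (λ s → orderIso s pat132) (map (x ∷_) (subseqs 2 w)) _)
          (cong₂ _∨_ (trans (anyB-map (λ s → orderIso s pat132) (x ∷_) (subseqs 2 w)) (anyB-132-starting-with x w))
                     (contains-132 w))

  hasIncAbove-max : ∀ b k w → All (_≤ b) w → hasIncAbove b (suc k) w ≡ false
  hasIncAbove-max b k []      []          = refl
  hasIncAbove-max b k (a ∷ w) (a≤b ∷ w≤b) rewrite <ᵇ-false a≤b = hasIncAbove-max b k w w≤b

  hasIncAbove-∷ʳ-max : ∀ n b k α → All (_< n) α → b < n →
                       hasIncAbove b (suc k) (α ++ n ∷ []) ≡ hasIncAbove b k α
  hasIncAbove-∷ʳ-max n b zero    []      []          b<n rewrite <ᵇ-true b<n = refl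
  hasIncAbove-∷ʳ-max n b (suc k) []      []          b<n rewrite <ᵇ-true b<n = refl
  hasIncAbove-∷ʳ-max n b zero    (a ∷ α) (_ ∷ α<n)   b<n
    rewrite hasIncAbove-∷ʳ-max n b zero α α<n b<n = ∨-zeroʳ _
  hasIncAbove-∷ʳ-max n b (suc k) (a ∷ α) (a<n ∷ α<n) b<n =
    cong₂ (λ u v → ((b <ᵇ a) ∧ u) ∨ v) (hasIncAbove-∷ʳ-max n a k α α<n a<n)
                                        (hasIncAbove-∷ʳ-max n b (suc k) α α<n b<n)

  hasInc-∷ʳ-max : ∀ n k α → All (_< n) α → hasInc k (α ++ n ∷ []) ≡ hasInc (k ∸ 1) α
  hasInc-∷ʳ-max n zero          α       _           = refl
  hasInc-∷ʳ-max n (suc zero)    []      []          = refl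
  hasInc-∷ʳ-max n (suc (suc k)) []      []          = refl
  hasInc-∷ʳ-max n (suc zero)    (a ∷ α) _           = refl
  hasInc-∷ʳ-max n (suc (suc k)) (a ∷ α) (a<n ∷ α<n) =
    cong₂ _∨_ (hasIncAbove-∷ʳ-max n a k α α<n a<n) (hasInc-∷ʳ-max n (suc (suc k)) α α<n)

  hasInc-∷-max : ∀ N k c w → All (_≤ N) (c ∷ w) → hasInc k (N ∷ c ∷ w) ≡ hasInc k (c ∷ w)
  hasInc-∷-max N zero          c w _    = refl
  hasInc-∷-max N (suc zero)    c w _    = refl
  hasInc-∷-max N (suc (suc k)) c w ≤N rewrite hasIncAbove-max N k (c ∷ w) ≤N = refl

  hasIncAbove-++ : ∀ b k x y → All (_≤ b) y → Above x y → hasIncAbove b k (x ++ y) ≡ hasIncAbove b k x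
  hasIncAbove-++ b zero    x       y y≤b _               = refl
  hasIncAbove-++ b (suc k) []      y y≤b _               = hasIncAbove-max b k y y≤b
  hasIncAbove-++ b (suc k) (a ∷ x) y y≤b (y<a ∷ x-above) =
    cong₂ (λ u v → ((b <ᵇ a) ∧ u) ∨ v) (hasIncAbove-++ a k x y (All.map ℕ.<⇒≤ y<a) x-above)
                                        (hasIncAbove-++ b (suc k) x y y≤b x-above)

  hasInc-++ : ∀ k x y → Above x y → hasInc k (x ++ y) ≡ hasInc k x ∨ hasInc k y
  hasInc-++ zero    x       y _               = refl
  hasInc-++ (suc k) []      y _               = refl
  hasInc-++ (suc k) (a ∷ x) y (y<a ∷ x-above) =
    trans (cong₂ _∨_ (hasIncAbove-++ a k x y (All.map ℕ.<⇒≤ y<a) x-above) (hasInc-++ (suc k) x y x-above))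
          (sym (∨-assoc (hasIncAbove a k x) _ _))

  hasIncAbove-shift : ∀ c b k w → hasIncAbove (c + b) k (map (c +_) w) ≡ hasIncAbove b k w
  hasIncAbove-shift c b zero    w       = refl
  hasIncAbove-shift c b (suc k) []      = refl
  hasIncAbove-shift c b (suc k) (a ∷ w) =
    cong₂ _∨_ (cong₂ _∧_ (+-<ᵇ c b a) (hasIncAbove-shift c a k w)) (hasIncAbove-shift c b (suc k) w)

  hasInc-shift : ∀ c k w → hasInc k (map (c +_) w) ≡ hasInc k w
  hasInc-shift c zero    w       = refl
  hasInc-shift c (suc k) []      = refl
  hasInc-shift c (suc k) (a ∷ w) = cong₂ _∨_ (hasIncAbove-shift c a k w) (hasInc-shift c (suc k) w)

  has32Above-below : ∀ a y → All (_< a) y → has32Above a y ≡ false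
  has32Above-below a []      []          = refl
  has32Above-below a (b ∷ y) (b<a ∷ y<a) rewrite <ᵇ-false (ℕ.<⇒≤ b<a) = has32Above-below a y y<a

  has32Above-++-below : ∀ a x y → All (_< a) y → has32Above a (x ++ y) ≡ has32Above a x
  has32Above-++-below a []      y y<a = has32Above-below a y y<a
  has32Above-++-below a (b ∷ x) y y<a =
    cong₂ (λ u v → ((a <ᵇ b) ∧ u) ∨ v) middle-in-x (has32Above-++-below a x y y<a)
    where
    P : ℕ → Bool
    P c = (a <ᵇ c) ∧ not (b <ᵇ c)
    middle-in-x : anyB P (x ++ y) ≡ anyB P x
    middle-in-x = begin
      anyB P (x ++ y)       ≡⟨ anyB-++ P x y ⟩
      anyB P x ∨ anyB P y   ≡⟨ cong (anyB P x ∨_) (anyB-false P y below-a) ⟩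
      anyB P x ∨ false      ≡⟨ ∨-identityʳ _ ⟩
      anyB P x              ∎
      where
      open ≡-Reasoning
      below-a : ∀ {c} → c ∈ y → P c ≡ false
      below-a {c} c∈y = cong (_∧ not (b <ᵇ c)) (<ᵇ-false (ℕ.<⇒≤ (All.lookup y<a c∈y)))

  has132-++ : ∀ x y → Above x y → has132 (x ++ y) ≡ has132 x ∨ has132 y
  has132-++ []      y _               = refl
  has132-++ (a ∷ x) y (y<a ∷ x-above) =
    trans (cong₂ _∨_ (has32Above-++-below a x y y<a) (has132-++ x y x-above)) (sym (∨-assoc (has32Above a x) _ _))

  has32Above-∷ʳ-max : ∀ n a x → All (_< n) x → has32Above a (x ++ n ∷ []) ≡ has32Above a x
  has32Above-∷ʳ-max n a []      []          = cong (_∨ false) (∧-zeroʳ (a <ᵇ n))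
  has32Above-∷ʳ-max n a (b ∷ x) (b<n ∷ x<n) =
    cong₂ (λ u v → ((a <ᵇ b) ∧ u) ∨ v)
          (trans (anyB-++ _ x (n ∷ [])) (trans (cong (anyB _ x ∨_) n-not-middle) (∨-identityʳ _)))
          (has32Above-∷ʳ-max n a x x<n)
    where
    n-not-middle : (((a <ᵇ n) ∧ not (b <ᵇ n)) ∨ false) ≡ false
    n-not-middle rewrite <ᵇ-true b<n = trans (∨-identityʳ _) (∧-zeroʳ _)

  has132-∷ʳ-max : ∀ n x → All (_< n) x → has132 (x ++ n ∷ []) ≡ has132 x
  has132-∷ʳ-max n []      []          = refl
  has132-∷ʳ-max n (a ∷ x) (_ ∷ x<n) = cong₂ _∨_ (has32Above-∷ʳ-max n a x x<n) (has132-∷ʳ-max n x x<n)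

  has32Above-++ʳ : ∀ a x y → has32Above a y ≡ true → has32Above a (x ++ y) ≡ true
  has32Above-++ʳ a []      y h = h
  has32Above-++ʳ a (b ∷ x) y h rewrite has32Above-++ʳ a x y h = ∨-zeroʳ _

  has132-++ʳ : ∀ x y → has132 y ≡ true → has132 (x ++ y) ≡ true
  has132-++ʳ []      y h = h
  has132-++ʳ (a ∷ x) y h rewrite has132-++ʳ x y h = ∨-zeroʳ _

  -- a N b with a < b < N is an occurrence of 132.
  has132-false-split : ∀ α N β → has132 (α ++ N ∷ β) ≡ false →
                       ∀ {a b} → a ∈ α → b ∈ β → a < b → b < N → ⊥
  has132-false-split α N β avoids {a} {b} a∈α b∈β a<b b<N with ∈-∃++ a∈α
  ... | α₁ , α₂ , refl = case trans (sym occurrence) (trans (cong has132 reassoc) avoids) of λ ()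
    where
    reassoc : α₁ ++ a ∷ (α₂ ++ N ∷ β) ≡ (α₁ ++ a ∷ α₂) ++ N ∷ β
    reassoc = sym (List.++-assoc α₁ (a ∷ α₂) (N ∷ β))
    b-between : ((a <ᵇ b) ∧ not (N <ᵇ b)) ≡ true
    b-between = cong₂ (λ u v → u ∧ not v) (<ᵇ-true a<b) (<ᵇ-false (ℕ.<⇒≤ b<N))
    a-then-N-b : has32Above a (N ∷ β) ≡ true
    a-then-N-b rewrite <ᵇ-true (ℕ.<-trans a<b b<N) | anyB-true (λ c → (a <ᵇ c) ∧ not (N <ᵇ c)) b∈β b-between = refl
    occurrence : has132 (α₁ ++ a ∷ (α₂ ++ N ∷ β)) ≡ true
    occurrence = has132-++ʳ α₁ (a ∷ (α₂ ++ N ∷ β))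
                            (cong (_∨ has132 (α₂ ++ N ∷ β)) (has32Above-++ʳ a α₂ (N ∷ β) a-then-N-b))

  has32Above-shift : ∀ c a w → has32Above (c + a) (map (c +_) w) ≡ has32Above a w
  has32Above-shift c a []      = refl
  has32Above-shift c a (b ∷ w) =
    cong₂ _∨_ (cong₂ _∧_ (+-<ᵇ c a b)
                         (trans (anyB-map _ (c +_) w)
                                (anyB-cong w (λ {d} _ → cong₂ (λ u v → u ∧ not v) (+-<ᵇ c a d) (+-<ᵇ c b d)))))
              (has32Above-shift c a w)

  has132-shift : ∀ c w → has132 (map (c +_) w) ≡ has132 w
  has132-shift c []      = refl
  has132-shift c (a ∷ w) = cong₂ _∨_ (has32Above-shift c a w) (has132-shift c w)

  avoids132-max-splits : ∀ {n} α β → IsPerm n (α ++ n ∷ β) → has132 (α ++ n ∷ β) ≡ false → Above α β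
  avoids132-max-splits {n} α β π avoids = All.tabulate λ a∈α → All.tabulate λ b∈β → b<a a∈α b∈β
    where
    open IsPerm π
    n∉ = proj₁ (unique-middle⁻ α unique)
    b<a : ∀ {a b} → a ∈ α → b ∈ β → b < a
    b<a {a} {b} a∈α b∈β =
      ℕ.≤∧≢⇒< (ℕ.≮⇒≥ (λ a<b → has132-false-split α n β avoids a∈α b∈β a<b b<n))
               (λ b≡a → unique-++-disjoint α (proj₂ (unique-middle⁻ α unique)) a∈α b∈β (sym b≡a))
      where
      b<n : b < n
      b<n = ℕ.≤∧≢⇒< (proj₂ (bounded (∈-++⁺ʳ α (there b∈β)))) (λ { refl → n∉ (∈-++⁺ʳ α b∈β) })

  -- Dumont permutations

  dumontStep : ℕ → ℕ → Bool
  dumontStep a b = if evenB a then b <ᵇ a else a <ᵇ b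

  dumontBefore : List ℕ → ℕ → Bool
  dumontBefore []          n = true
  dumontBefore (a ∷ [])    n = dumontStep a n
  dumontBefore (a ∷ b ∷ w) n = dumontStep a b ∧ dumontBefore (b ∷ w) n

  dumont-++ : ∀ x n y → dumont (x ++ n ∷ y) ≡ dumontBefore x n ∧ dumont (n ∷ y)
  dumont-++ []          n y = refl
  dumont-++ (a ∷ [])    n y = refl
  dumont-++ (a ∷ b ∷ x) n y =
    trans (cong (dumontStep a b ∧_) (dumont-++ (b ∷ x) n y)) (sym (∧-assoc (dumontStep a b) _ _))

  dumontBefore-max : ∀ n x → All (_< n) x → dumontBefore x n ≡ dumont x
  dumontBefore-max n []          []          = refl
  dumontBefore-max n (a ∷ [])    (a<n ∷ [])  with evenB a
  ... | true  = <ᵇ-false (ℕ.<⇒≤ a<n)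
  ... | false = <ᵇ-true a<n
  dumontBefore-max n (a ∷ b ∷ x) (_ ∷ bx<n) = cong (dumontStep a b ∧_) (dumontBefore-max n (b ∷ x) bx<n)

  dumont-∷ʳ-max : ∀ n x → All (_< n) x → evenB n ≡ false → dumont (x ++ n ∷ []) ≡ dumont x
  dumont-∷ʳ-max n x x<n n-odd rewrite dumont-++ x n [] | dumontBefore-max n x x<n | n-odd = ∧-identityʳ (dumont x)

  dumont-∷-even : ∀ N c w → evenB N ≡ true → c < N → dumont (N ∷ c ∷ w) ≡ dumont (c ∷ w)
  dumont-∷-even N c w N-even c<N rewrite N-even | <ᵇ-true c<N = refl

  dumont-odd-descent : ∀ n α c β → evenB n ≡ false → c ≤ n → dumont (α ++ n ∷ c ∷ β) ≡ false
  dumont-odd-descent n α c β n-odd c≤n rewrite dumont-++ α n (c ∷ β) | n-odd | <ᵇ-false c≤n = ∧-zeroʳ _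

  dumont-even-ascent : ∀ α e x z → evenB e ≡ true → e ≤ x → dumont (α ++ e ∷ x ∷ z) ≡ false
  dumont-even-ascent α e x z e-even e≤x rewrite dumont-++ α e (x ∷ z) | e-even | <ᵇ-false e≤x = ∧-zeroʳ _

  dumont-even-last : ∀ α e → evenB e ≡ true → dumont (α ++ e ∷ []) ≡ false
  dumont-even-last α e e-even rewrite dumont-++ α e [] | e-even = ∧-zeroʳ _

  dumont-min-odd : ∀ γ x z {e} → dumont (γ ++ x ∷ z) ≡ true → e ∈ γ → All (e ≤_) γ → e ≤ x →
                   evenB e ≡ false
  dumont-min-odd γ x z {e} γxz-dumont e∈γ e≤γ e≤x with evenB e in e-parity | ∈-∃++ e∈γ
  ... | false | _ = refl
  ... | true  | γ₁ , γ₂ , refl =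
    case trans (sym γxz-dumont) (trans (cong dumont (List.++-assoc γ₁ (e ∷ γ₂) (x ∷ z)))
                                       (ascent γ₂ (All.++⁻ʳ γ₁ e≤γ))) of λ ()
    where
    ascent : ∀ γ₂ → All (e ≤_) (e ∷ γ₂) → dumont (γ₁ ++ e ∷ (γ₂ ++ x ∷ z)) ≡ false
    ascent []       _             = dumont-even-ascent γ₁ e x z e-parity e≤x
    ascent (d ∷ γ₂) (_ ∷ e≤d ∷ _) = dumont-even-ascent γ₁ e d (γ₂ ++ x ∷ z) e-parity e≤d

  evenB-double-+ : ∀ j a → evenB (double j + a) ≡ evenB a
  evenB-double-+ zero    a = refl
  evenB-double-+ (suc j) a = evenB-double-+ j a

  double-+ : ∀ a b → double a + double b ≡ double (a + b)
  double-+ zero    b = refl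
  double-+ (suc a) b = cong (suc ∘ suc) (double-+ a b)

  dumont-shift : ∀ j w → dumont (map (double j +_) w) ≡ dumont w
  dumont-shift j []          = refl
  dumont-shift j (a ∷ [])    = cong not (evenB-double-+ j a)
  dumont-shift j (a ∷ b ∷ w) = cong₂ _∧_ step (dumont-shift j (b ∷ w))
    where
    step : dumontStep (double j + a) (double j + b) ≡ dumontStep a b
    step rewrite evenB-double-+ j a | +-<ᵇ (double j) a b | +-<ᵇ (double j) b a = refl

  admissible : ℕ → List ℕ → Bool
  admissible k w = dumont w ∧ avoids pat132 w ∧ avoids (incPat k) w

  admissible-unfold : ∀ k w → admissible k w ≡ (dumont w ∧ (not (has132 w) ∧ not (hasInc k w)))
  admissible-unfold k w rewrite contains-132 w | contains-incPat k w = refl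

  admissible⇒dumont-avoids132 : ∀ k w → admissible k w ≡ true → dumont w ≡ true × has132 w ≡ false
  admissible⇒dumont-avoids132 k w w-adm with ∧-true⁻ (trans (sym (admissible-unfold k w)) w-adm)
  ... | w-dumont , avoids = w-dumont , not-true⁻ (proj₁ (∧-true⁻ avoids))

  admissible-cong : ∀ k k′ w w′ → dumont w ≡ dumont w′ → has132 w ≡ has132 w′ → hasInc k w ≡ hasInc k′ w′ →
                    admissible k w ≡ admissible k′ w′
  admissible-cong k k′ w w′ d≡ h≡ i≡ = begin
    admissible k w                                      ≡⟨ admissible-unfold k w ⟩
    dumont w ∧ (not (has132 w) ∧ not (hasInc k w))      ≡⟨ cong₂ (λ d hi → d ∧ hi) d≡ (cong₂ (λ h i → not h ∧ not i) h≡ i≡) ⟩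
    dumont w′ ∧ (not (has132 w′) ∧ not (hasInc k′ w′))  ≡⟨ sym (admissible-unfold k′ w′) ⟩
    admissible k′ w′                                    ∎
    where open ≡-Reasoning

  admissible-∷ʳ-odd-max : ∀ k n α → All (_< n) α → evenB n ≡ false →
                          admissible k (α ++ n ∷ []) ≡ admissible (k ∸ 1) α
  admissible-∷ʳ-odd-max k n α α<n n-odd = admissible-cong k (k ∸ 1) (α ++ n ∷ []) α
    (dumont-∷ʳ-max n α α<n n-odd) (has132-∷ʳ-max n α α<n) (hasInc-∷ʳ-max n k α α<n)

  admissible-shift : ∀ k j α → admissible k (map (double j +_) α) ≡ admissible k α
  admissible-shift k j α = admissible-cong k k (map (double j +_) α) α
    (dumont-shift j α) (has132-shift (double j) α) (hasInc-shift (double j) k α)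

  -- Odd length

  dropLast : List ℕ → List ℕ
  dropLast []          = []
  dropLast (a ∷ [])    = []
  dropLast (a ∷ b ∷ w) = a ∷ dropLast (b ∷ w)

  dropLast-∷ʳ : ∀ α x → dropLast (α ++ x ∷ []) ≡ α
  dropLast-∷ʳ []          x = refl
  dropLast-∷ʳ (a ∷ [])    x = refl
  dropLast-∷ʳ (a ∷ b ∷ α) x = cong (a ∷_) (dropLast-∷ʳ (b ∷ α) x)

  odd-perm-ends-with-max : ∀ m π → IsPerm (suc (double m)) π → dumont π ≡ true →
    ∃ λ α → π ≡ α ++ suc (double m) ∷ [] × IsPerm (double m) α
  odd-perm-ends-with-max m π is-perm π-dumont with ∈-∃++ (IsPerm-∋ is-perm (s≤s z≤n) ℕ.≤-refl)
  ... | α , [] , refl = α , refl , subst (IsPerm (double m)) (List.++-identityʳ α) (IsPerm-remove-max α is-perm)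
  ... | α , c ∷ β , refl = case trans (sym π-dumont) (dumont-odd-descent _ α c β (evenB-suc-double m) c≤n) of λ ()
    where
    c≤n : c ≤ suc (double m)
    c≤n = proj₂ (IsPerm.bounded is-perm (∈-++⁺ʳ α (there (here refl))))

  count-odd : ∀ k m → countB (admissible k) (perms (suc (double m))) ≡ countB (admissible (k ∸ 1)) (perms (double m))
  count-odd k m = countB-bijection (admissible k) (admissible (k ∸ 1)) dropLast (_++ n ∷ [])
    (perms n) (perms (double m)) (perms-unique n) (perms-unique (double m)) to to⁻¹
    where
    n = suc (double m)
    admissible-∷ʳ-n : ∀ {α} → IsPerm (double m) α → admissible k (α ++ n ∷ []) ≡ admissible (k ∸ 1) α
    admissible-∷ʳ-n {α} α-perm = admissible-∷ʳ-odd-max k n α (IsPerm⇒<suc α-perm) (evenB-suc-double m)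
    to : ∀ {π} → π ∈ perms n → admissible k π ≡ true →
         dropLast π ∈ perms (double m) × admissible (k ∸ 1) (dropLast π) ≡ true × dropLast π ++ n ∷ [] ≡ π
    to {π} π∈ π-adm with odd-perm-ends-with-max m π (∈-perms⁻ n π∈) (proj₁ (∧-true⁻ π-adm))
    ... | α , refl , α-perm rewrite dropLast-∷ʳ α n =
      ∈-perms⁺ (double m) α-perm , trans (sym (admissible-∷ʳ-n α-perm)) π-adm , refl
    to⁻¹ : ∀ {α} → α ∈ perms (double m) → admissible (k ∸ 1) α ≡ true →
           α ++ n ∷ [] ∈ perms n × admissible k (α ++ n ∷ []) ≡ true × dropLast (α ++ n ∷ []) ≡ α
    to⁻¹ {α} α∈ α-adm = let α-perm = ∈-perms⁻ (double m) α∈ in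
      ∈-perms⁺ n (IsPerm-∷ʳ α α-perm) , trans (admissible-∷ʳ-n α-perm) α-adm , dropLast-∷ʳ α n

  -- Even length

  breakAt : ℕ → List ℕ → List ℕ × List ℕ
  breakAt n []      = [] , []
  breakAt n (a ∷ w) = if a ≡ᵇ n then ([] , w) else (a ∷ proj₁ (breakAt n w) , proj₂ (breakAt n w))

  breakAt-++ : ∀ n α β → n ∉ α → breakAt n (α ++ n ∷ β) ≡ (α , β)
  breakAt-++ n []      β _   rewrite ≡ᵇ-refl n = refl
  breakAt-++ n (a ∷ α) β n∉
    rewrite ≡ᵇ-false (λ a≡n → n∉ (here (sym a≡n))) | breakAt-++ n α β (n∉ ∘ there) = refl

  module EvenLength (m : ℕ) where

    N M : ℕ
    N = suc (suc (double m))
    M = suc (double m)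

    M<N : M < N
    M<N = ℕ.≤-refl

    block : ℕ → List (List ℕ × List ℕ)
    block i = cartesianProduct (perms (double i)) (perms (double (m ∸ i)))

    blocksBelow : ℕ → List (List ℕ × List ℕ)
    blocksBelow zero    = []
    blocksBelow (suc i) = blocksBelow i ++ block i

    splits : List (List ℕ × List ℕ)
    splits = blocksBelow (suc m)

    ∈-blocksBelow⁻ : ∀ i {y} → y ∈ blocksBelow i → ∃ λ i′ → i′ < i × y ∈ block i′
    ∈-blocksBelow⁻ (suc i) y∈ with ∈-++⁻ (blocksBelow i) y∈
    ... | inj₁ y∈′ = let i′ , i′<i , y∈b = ∈-blocksBelow⁻ i y∈′ in i′ , ℕ.m≤n⇒m≤1+n i′<i , y∈b
    ... | inj₂ y∈b = i , ℕ.≤-refl , y∈b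

    ∈-blocksBelow⁺ : ∀ i {i′ y} → i′ < i → y ∈ block i′ → y ∈ blocksBelow i
    ∈-blocksBelow⁺ (suc i) i′<1+i y∈ with ℕ.m≤n⇒m<n∨m≡n (ℕ.≤-pred i′<1+i)
    ... | inj₁ i′<i = ∈-++⁺ˡ (∈-blocksBelow⁺ i i′<i y∈)
    ... | inj₂ refl = ∈-++⁺ʳ (blocksBelow i) y∈

    length-block : ∀ i {y} → y ∈ block i → length (proj₁ y) ≡ double i
    length-block i {α , β} y∈ = IsPerm.length≡ (∈-perms⁻ (double i) (proj₁ (∈-cartesianProduct⁻ _ _ y∈)))

    blocksBelow-unique : ∀ i → Unique (blocksBelow i)
    blocksBelow-unique zero    = []
    blocksBelow-unique (suc i) =
      Unique.++⁺ (blocksBelow-unique i) block-unique disjoint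
      where
      block-unique = Unique.cartesianProduct⁺ (perms-unique (double i)) (perms-unique (double (m ∸ i)))
      disjoint : ∀ {y} → y ∈ blocksBelow i × y ∈ block i → ⊥
      disjoint (y∈ , y∈b) with ∈-blocksBelow⁻ i y∈
      ... | i′ , i′<i , y∈b′ =
        ℕ.<-irrefl (double-injective (trans (sym (length-block i′ y∈b′)) (length-block i y∈b))) i′<i

    data Split : List ℕ × List ℕ → Set where
      valley : ∀ {α} → IsPerm (double m) α → Split (α , [])
      peak   : ∀ {i α c β} → i < m → IsPerm (double i) α → IsPerm (double (m ∸ i)) (c ∷ β) → Split (α , c ∷ β)

    split-of-perms : ∀ {i α} β → i ≤ m → IsPerm (double i) α → IsPerm (double (m ∸ i)) β → Split (α , β)
    split-of-perms {i} [] i≤m α-perm β-perm with ℕ.m≤n⇒m<n∨m≡n i≤m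
    ... | inj₂ refl = valley α-perm
    ... | inj₁ i<m with m ∸ i | ℕ.m<n⇒0<n∸m i<m | IsPerm.length≡ β-perm
    ... | suc _ | _ | ()
    split-of-perms {i} (c ∷ β) i≤m α-perm β-perm with ℕ.m≤n⇒m<n∨m≡n i≤m
    ... | inj₁ i<m  = peak i<m α-perm β-perm
    ... | inj₂ refl = case trans (IsPerm.length≡ β-perm) (cong double (ℕ.n∸n≡0 i)) of λ ()

    ∈-splits⁻ : ∀ {y} → y ∈ splits → Split y
    ∈-splits⁻ {α , β} y∈ with ∈-blocksBelow⁻ (suc m) y∈
    ... | i , i<1+m , y∈b with ∈-cartesianProduct⁻ (perms (double i)) _ y∈b
    ... | α∈ , β∈ = split-of-perms β (ℕ.≤-pred i<1+m) (∈-perms⁻ _ α∈) (∈-perms⁻ _ β∈)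

    ∈-splits⁺ : ∀ {y} → Split y → y ∈ splits
    ∈-splits⁺ (valley α-perm) = ∈-++⁺ʳ (blocksBelow m) (∈-cartesianProduct⁺ (∈-perms⁺ _ α-perm) []∈)
      where
      []∈ : [] ∈ perms (double (m ∸ m))
      []∈ = subst (λ t → [] ∈ perms (double t)) (sym (ℕ.n∸n≡0 m)) (here refl)
    ∈-splits⁺ (peak i<m α-perm β-perm) =
      ∈-blocksBelow⁺ (suc m) (ℕ.m≤n⇒m≤1+n i<m)
                     (∈-cartesianProduct⁺ (∈-perms⁺ _ α-perm) (∈-perms⁺ _ β-perm))

    splits-unique : Unique splits
    splits-unique = blocksBelow-unique (suc m)

    splitAdmissible : ℕ → List ℕ × List ℕ → Bool
    splitAdmissible k (α , [])    = admissible (k ∸ 1) α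
    splitAdmissible k (α , c ∷ β) = admissible (k ∸ 2) α ∧ admissible k (c ∷ β)

    countB-blocksBelow : ∀ k i →
      countB (splitAdmissible k) (blocksBelow i) ≡ sumBelowℕ (λ i′ → countB (splitAdmissible k) (block i′)) i
    countB-blocksBelow k zero    = refl
    countB-blocksBelow k (suc i) =
      trans (countB-++ (splitAdmissible k) (blocksBelow i) (block i))
            (cong (_+ countB (splitAdmissible k) (block i)) (countB-blocksBelow k i))

    count-splits : ∀ k → countB (splitAdmissible k) splits
      ≡ sumBelowℕ (λ i → countB (admissible (k ∸ 2)) (perms (double i))
                         * countB (admissible k) (perms (double (m ∸ i)))) m
        + countB (admissible (k ∸ 1)) (perms (double m))
    count-splits k = trans (countB-blocksBelow k (suc m)) (cong₂ _+_ (sumBelowℕ-cong m inner) last)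
      where
      inner : ∀ {i} → i < m →
        countB (splitAdmissible k) (block i)
        ≡ countB (admissible (k ∸ 2)) (perms (double i)) * countB (admissible k) (perms (double (m ∸ i)))
      inner {i} i<m = countB-cartesianProduct (splitAdmissible k) (admissible (k ∸ 2)) (admissible k) _ _ nonempty-β
        where
        nonempty-β : ∀ {α β} → α ∈ perms (double i) → β ∈ perms (double (m ∸ i)) →
                     splitAdmissible k (α , β) ≡ (admissible (k ∸ 2) α ∧ admissible k β)
        nonempty-β {β = c ∷ β} _ _ = refl
        nonempty-β {β = []} _ []∈
          with m ∸ i | ℕ.m<n⇒0<n∸m i<m | IsPerm.length≡ (∈-perms⁻ (double (m ∸ i)) []∈)
        ... | suc _ | _ | ()
      last : countB (splitAdmissible k) (block m) ≡ countB (admissible (k ∸ 1)) (perms (double m))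
      last rewrite ℕ.n∸n≡0 m =
        trans (countB-cartesianProduct (splitAdmissible k) (admissible (k ∸ 1)) (λ _ → true) (perms (double m)) ([] ∷ [])
                 (λ { {α} _ (here refl) → sym (∧-identityʳ (admissible (k ∸ 1) α)) }))
              (ℕ.*-identityʳ _)

    glue : List ℕ × List ℕ → List ℕ
    glue (α , [])    = N ∷ (α ++ M ∷ [])
    glue (α , c ∷ β) = map (length (c ∷ β) +_) α ++ M ∷ N ∷ c ∷ β

    unglue : List ℕ × List ℕ → List ℕ × List ℕ
    unglue ([] , β)    = dropLast β , []
    unglue (a ∷ α , β) = map (_∸ length β) (dropLast (a ∷ α)) , β

    cut : List ℕ → List ℕ × List ℕ
    cut π = unglue (breakAt N π)

    unglue-∷ʳ : ∀ γ x β → unglue (γ ++ x ∷ [] , β) ≡ (map (_∸ length β) γ , β)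
    unglue-∷ʳ []      x β = refl
    unglue-∷ʳ (a ∷ γ) x β = cong (λ δ → map (_∸ length β) δ , β) (dropLast-∷ʳ (a ∷ γ) x)

    N-even : evenB N ≡ true
    N-even = evenB-double (suc m)

    M-odd : evenB M ≡ false
    M-odd = evenB-suc-double m

    admissible-valley : ∀ k α → All (_< M) α → admissible k (N ∷ (α ++ M ∷ [])) ≡ admissible (k ∸ 1) α
    admissible-valley k α α<M = admissible-cong k (k ∸ 1) (N ∷ (α ++ M ∷ [])) α
      (trans (proj₁ (drop-N α α<M)) (dumont-∷ʳ-max M α α<M M-odd))
      (trans (has132-++ (N ∷ []) (α ++ M ∷ []) (αM<N ∷ [])) (has132-∷ʳ-max M α α<M))
      (trans (proj₂ (drop-N α α<M)) (hasInc-∷ʳ-max M k α α<M))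
      where
      αM<N : All (_< N) (α ++ M ∷ [])
      αM<N = All.++⁺ (All.map (λ a<M → ℕ.<-trans a<M M<N) α<M) (M<N ∷ [])
      drop-N : ∀ α → All (_< M) α →
        dumont (N ∷ (α ++ M ∷ [])) ≡ dumont (α ++ M ∷ [])
        × hasInc k (N ∷ (α ++ M ∷ [])) ≡ hasInc k (α ++ M ∷ [])
      drop-N []      []          = dumont-∷-even N M [] N-even M<N , hasInc-∷-max N k M [] (ℕ.<⇒≤ M<N ∷ [])
      drop-N (a ∷ α) (a<M ∷ α<M) =
        dumont-∷-even N a (α ++ M ∷ []) N-even (ℕ.<-trans a<M M<N) ,
        hasInc-∷-max N k a (α ++ M ∷ []) (All.map ℕ.<⇒≤ aαM<N)
        where
        aαM<N = All.++⁺ (All.map (λ b<M → ℕ.<-trans b<M M<N) (a<M ∷ α<M)) (M<N ∷ [])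

    admissible-peak : ∀ k γ c β → All (_≤ double m) (γ ++ c ∷ β) → Above γ (c ∷ β) →
      admissible k (γ ++ M ∷ N ∷ c ∷ β) ≡ (admissible (k ∸ 2) γ ∧ admissible k (c ∷ β))
    admissible-peak k γ c β ≤2m γ-above = begin
      admissible k π
        ≡⟨ admissible-unfold k π ⟩
      dumont π ∧ (not (has132 π) ∧ not (hasInc k π))
        ≡⟨ cong₂ (λ d hi → d ∧ hi) dumont-π (cong₂ (λ h i → not h ∧ not i) has132-π hasInc-π) ⟩
      (dumont γ ∧ dumont cβ) ∧ (not (has132 γ ∨ has132 cβ) ∧ not (hasInc (k ∸ 2) γ ∨ hasInc k cβ))
        ≡⟨ ∧-not-∨-interchange (dumont γ) (dumont cβ) (has132 γ) (has132 cβ) (hasInc (k ∸ 2) γ) (hasInc k cβ) ⟩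
      (dumont γ ∧ (not (has132 γ) ∧ not (hasInc (k ∸ 2) γ))) ∧ (dumont cβ ∧ (not (has132 cβ) ∧ not (hasInc k cβ)))
        ≡⟨ sym (cong₂ _∧_ (admissible-unfold (k ∸ 2) γ) (admissible-unfold k cβ)) ⟩
      admissible (k ∸ 2) γ ∧ admissible k (c ∷ β) ∎
      where
      open ≡-Reasoning
      cβ = c ∷ β
      π = γ ++ M ∷ N ∷ cβ
      γ<M : All (_< M) γ
      γ<M = All.map s≤s (All.++⁻ˡ γ ≤2m)
      cβ<M : All (_< M) (c ∷ β)
      cβ<M = All.map s≤s (All.++⁻ʳ γ ≤2m)
      γM<N : All (_< N) (γ ++ M ∷ [])
      γM<N = All.++⁺ (All.map (λ a<M → ℕ.<-trans a<M M<N) γ<M) (M<N ∷ [])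
      reassoc : π ≡ ((γ ++ M ∷ []) ++ N ∷ []) ++ c ∷ β
      reassoc = trans (sym (List.++-assoc γ (M ∷ N ∷ []) cβ)) (cong (_++ cβ) (sym (List.++-assoc γ (M ∷ []) (N ∷ []))))
      above : Above ((γ ++ M ∷ []) ++ N ∷ []) (c ∷ β)
      above = All.++⁺ (All.++⁺ γ-above (cβ<M ∷ [])) (All.map (λ b<M → ℕ.<-trans b<M M<N) cβ<M ∷ [])
      dumont-π : dumont π ≡ (dumont γ ∧ dumont (c ∷ β))
      dumont-π rewrite dumont-++ γ M (N ∷ c ∷ β) | dumontBefore-max M γ γ<M | M-odd | <ᵇ-true M<N
                     | dumont-∷-even N c β N-even (ℕ.<-trans (All.head cβ<M) M<N) = refl
      has132-π : has132 π ≡ (has132 γ ∨ has132 (c ∷ β))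
      has132-π rewrite reassoc | has132-++ ((γ ++ M ∷ []) ++ N ∷ []) (c ∷ β) above
                     | has132-∷ʳ-max N (γ ++ M ∷ []) γM<N | has132-∷ʳ-max M γ γ<M = refl
      hasInc-π : hasInc k π ≡ (hasInc (k ∸ 2) γ ∨ hasInc k (c ∷ β))
      hasInc-π rewrite reassoc | hasInc-++ k ((γ ++ M ∷ []) ++ N ∷ []) (c ∷ β) above
                     | hasInc-∷ʳ-max N k (γ ++ M ∷ []) γM<N | hasInc-∷ʳ-max M (k ∸ 1) γ γ<M
                     | ℕ.∸-+-assoc k 1 1 = refl

    IsPerm-insert-peak : ∀ γ w → IsPerm (double m) (γ ++ w) → IsPerm N (γ ++ M ∷ N ∷ w)
    IsPerm-insert-peak γ w π =
      subst (IsPerm N) (List.++-assoc γ (M ∷ []) (N ∷ w))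
            (IsPerm-insert-max (γ ++ M ∷ []) (subst (IsPerm M) (sym (List.++-assoc γ (M ∷ []) w))
                                                                (IsPerm-insert-max γ π)))

    module Peak {i α c β} (i<m : i < m) (α-perm : IsPerm (double i) α) (cβ-perm : IsPerm (double (m ∸ i)) (c ∷ β))
      where

      γ : List ℕ
      γ = map (double (m ∸ i) +_) α

      γ-cβ-perm : IsPerm (double m) (γ ++ c ∷ β)
      γ-cβ-perm = subst (λ n → IsPerm n (γ ++ c ∷ β)) 2i+2[m-i]≡2m (IsPerm-shift-++ α-perm cβ-perm)
        where
        2i+2[m-i]≡2m : double i + double (m ∸ i) ≡ double m
        2i+2[m-i]≡2m = trans (double-+ i (m ∸ i)) (cong double (ℕ.m+[n∸m]≡n (ℕ.<⇒≤ i<m)))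

      γ-above : Above γ (c ∷ β)
      γ-above = All.map⁺ (All.tabulate λ a∈α → All.tabulate λ b∈cβ →
        ℕ.≤-<-trans (proj₂ (IsPerm.bounded cβ-perm b∈cβ)) (ℕ.m<m+n _ (proj₁ (IsPerm.bounded α-perm a∈α))))

      glue≡ : glue (α , c ∷ β) ≡ γ ++ M ∷ N ∷ c ∷ β
      glue≡ = cong (λ j → map (j +_) α ++ M ∷ N ∷ c ∷ β) (IsPerm.length≡ cβ-perm)

    glue-perm : ∀ {y} → Split y → IsPerm N (glue y)
    glue-perm (valley α-perm) = IsPerm-insert-max [] (IsPerm-∷ʳ _ α-perm)
    glue-perm {α , c ∷ β} (peak i<m α-perm cβ-perm) =
      subst (IsPerm N) (sym glue≡) (IsPerm-insert-peak γ (c ∷ β) γ-cβ-perm)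
      where open Peak i<m α-perm cβ-perm

    glue-admissible : ∀ k {y} → Split y → admissible k (glue y) ≡ splitAdmissible k y
    glue-admissible k (valley α-perm) = admissible-valley k _ (IsPerm⇒<suc α-perm)
    glue-admissible k {α , c ∷ β} (peak {i} i<m α-perm cβ-perm) = begin
      admissible k (glue (α , c ∷ β))
        ≡⟨ cong (admissible k) glue≡ ⟩
      admissible k (γ ++ M ∷ N ∷ c ∷ β)
        ≡⟨ admissible-peak k γ c β (All.tabulate (proj₂ ∘ IsPerm.bounded γ-cβ-perm)) γ-above ⟩
      admissible (k ∸ 2) γ ∧ admissible k (c ∷ β)
        ≡⟨ cong (_∧ admissible k (c ∷ β)) (admissible-shift (k ∸ 2) (m ∸ i) α) ⟩
      admissible (k ∸ 2) α ∧ admissible k (c ∷ β) ∎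
      where
      open ≡-Reasoning
      open Peak i<m α-perm cβ-perm

    cut-glue : ∀ {y} → Split y → cut (glue y) ≡ y
    cut-glue {α , []} (valley _) =
      trans (cong unglue (breakAt-++ N [] (α ++ M ∷ []) (λ ()))) (cong (_, []) (dropLast-∷ʳ α M))
    cut-glue {α , c ∷ β} (peak {i} i<m α-perm cβ-perm) = begin
      cut (glue (α , c ∷ β))
        ≡⟨ cong cut glue≡ ⟩
      unglue (breakAt N (γ ++ M ∷ N ∷ c ∷ β))
        ≡⟨ cong (unglue ∘ breakAt N) (sym (List.++-assoc γ (M ∷ []) (N ∷ c ∷ β))) ⟩
      unglue (breakAt N ((γ ++ M ∷ []) ++ N ∷ c ∷ β))
        ≡⟨ cong unglue (breakAt-++ N (γ ++ M ∷ []) (c ∷ β) N∉γM) ⟩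
      unglue (γ ++ M ∷ [] , c ∷ β)
        ≡⟨ unglue-∷ʳ γ M (c ∷ β) ⟩
      (map (_∸ length (c ∷ β)) γ , c ∷ β)
        ≡⟨ cong (λ j → map (_∸ j) γ , c ∷ β) (IsPerm.length≡ cβ-perm) ⟩
      (map (_∸ double (m ∸ i)) γ , c ∷ β)
        ≡⟨ cong (_, c ∷ β) (map-∸-+ (double (m ∸ i)) α) ⟩
      (α , c ∷ β) ∎
      where
      open ≡-Reasoning
      open Peak i<m α-perm cβ-perm
      N∉γM : N ∉ γ ++ M ∷ []
      N∉γM N∈ with ∈-++⁻ γ N∈
      ... | inj₁ N∈γ      = ℕ.<⇒≱ (ℕ.m<n⇒m<1+n (ℕ.n<1+n _)) (proj₂ (IsPerm.bounded γ-cβ-perm (∈-++⁺ˡ N∈γ)))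
      ... | inj₂ (here N≡M) = ℕ.<-irrefl (sym N≡M) M<N

    -- The least entry |β| + 1 of the upper block γ ascends to its successor (or to M), so it is odd.
    shifted-block-even : ∀ γ j {z} → dumont (γ ++ M ∷ z) ≡ true → All (j <_) γ → All (_≤ double m) γ →
      IsPerm (length γ) (map (_∸ j) γ) → length γ + j ≡ double m → ∃ λ t → j ≡ double t
    shifted-block-even []      j _         _   _    _        j≡2m = m , j≡2m
    shifted-block-even (a ∷ γ) j γM-dumont γ>j γ≤2m γ-j-perm _
      with ∈-map⁻ (_∸ j) (IsPerm-∋ γ-j-perm (s≤s z≤n) (s≤s z≤n))
    ... | b , b∈ , 1≡b∸j = evenB-suc-false⇒double j (dumont-min-odd (a ∷ γ) M _ γM-dumont 1+j∈ γ>j 1+j≤M)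
      where
      b≡1+j : b ≡ suc j
      b≡1+j = begin
        b            ≡⟨ sym (ℕ.m+[n∸m]≡n (ℕ.<⇒≤ (All.lookup γ>j b∈))) ⟩
        j + (b ∸ j)  ≡⟨ cong (j +_) (sym 1≡b∸j) ⟩
        j + 1        ≡⟨ ℕ.+-comm j 1 ⟩
        suc j        ∎
        where open ≡-Reasoning
      1+j∈ : suc j ∈ a ∷ γ
      1+j∈ = subst (_∈ a ∷ γ) b≡1+j b∈
      1+j≤M : suc j ≤ M
      1+j≤M = subst (_≤ M) b≡1+j (ℕ.m≤n⇒m≤1+n (All.lookup γ≤2m b∈))

    peak-decompose : ∀ γ c β → IsPerm (double m) (γ ++ c ∷ β) → Above γ (c ∷ β) →
      dumont (γ ++ M ∷ N ∷ c ∷ β) ≡ true → ∃ λ y → Split y × glue y ≡ γ ++ M ∷ N ∷ c ∷ β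
    peak-decompose γ c β γcβ-perm γ-above π-dumont =
      (map (_∸ j) γ , c ∷ β) , peak i<m α-perm cβ-perm ,
      cong (_++ M ∷ N ∷ c ∷ β) (map-+-∸ j γ (All.map ℕ.<⇒≤ γ>j))
      where
      j = length (c ∷ β)
      g = length γ
      split = IsPerm-++-above γ (c ∷ β) γcβ-perm γ-above
      γ>j = proj₁ split
      g+j≡2m : g + j ≡ double m
      g+j≡2m = trans (sym (List.length-++ γ)) (IsPerm.length≡ γcβ-perm)
      j-even : ∃ λ t → j ≡ double t
      j-even = shifted-block-even γ j π-dumont γ>j (All.tabulate (proj₂ ∘ IsPerm.bounded γcβ-perm ∘ ∈-++⁺ˡ))
                                  (proj₂ (proj₂ split)) g+j≡2m
      t = proj₁ j-even
      i = m ∸ t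
      t≤m : t ≤ m
      t≤m = double-cancel-≤ (subst (_≤ double m) (proj₂ j-even) (subst (j ≤_) g+j≡2m (ℕ.m≤n+m j g)))
      0<t : 0 < t
      0<t with t | proj₂ j-even
      ... | suc _ | _ = s≤s z≤n
      i<m : i < m
      i<m = ℕ.∸-monoʳ-< 0<t t≤m
      α-perm : IsPerm (double i) (map (_∸ j) γ)
      α-perm = subst (λ n → IsPerm n (map (_∸ j) γ)) g≡2i (proj₂ (proj₂ split))
        where
        g≡2i : g ≡ double i
        g≡2i = trans (sym (ℕ.m+n∸n≡m g j)) (trans (cong₂ _∸_ g+j≡2m (proj₂ j-even)) (double-∸ m t))
      cβ-perm : IsPerm (double (m ∸ i)) (c ∷ β)
      cβ-perm = subst (λ n → IsPerm n (c ∷ β)) (trans (proj₂ j-even) (cong double (sym (ℕ.m∸[m∸n]≡n t≤m))))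
                      (proj₁ (proj₂ split))

    valley-decompose : ∀ c β → IsPerm N (N ∷ c ∷ β) → dumont (N ∷ c ∷ β) ≡ true →
      ∃ λ y → Split y × glue y ≡ N ∷ c ∷ β
    valley-decompose c β π-perm π-dumont with odd-perm-ends-with-max m (c ∷ β) cβ-perm cβ-dumont
      where
      cβ-perm : IsPerm M (c ∷ β)
      cβ-perm = IsPerm-remove-max [] π-perm
      cβ-dumont : dumont (c ∷ β) ≡ true
      cβ-dumont = trans (sym (dumont-∷-even N c β N-even (s≤s (proj₂ (IsPerm.bounded cβ-perm (here refl)))))) π-dumont
    ... | α , cβ≡αM , α-perm = (α , []) , valley α-perm , cong (N ∷_) (sym cβ≡αM)

    -- Everything before N lies above everything after it, so M (the largest remaining value) comes before N;
    -- being odd, M can only be followed by the larger N.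
    prefix-decompose : ∀ α c β → IsPerm N (α ++ N ∷ c ∷ β) → dumont (α ++ N ∷ c ∷ β) ≡ true →
      has132 (α ++ N ∷ c ∷ β) ≡ false → ∀ {a} → a ∈ α → ∃ λ y → Split y × glue y ≡ α ++ N ∷ c ∷ β
    prefix-decompose α c β π-perm π-dumont π-avoids {a} a∈α with ∈-∃++ M∈α
      where
      rest-perm : IsPerm M (α ++ c ∷ β)
      rest-perm = IsPerm-remove-max α π-perm
      above : Above α (c ∷ β)
      above = avoids132-max-splits α (c ∷ β) π-perm π-avoids
      M∈α : M ∈ α
      M∈α with ∈-++⁻ α (IsPerm-∋ rest-perm (s≤s z≤n) ℕ.≤-refl)
      ... | inj₁ M∈α  = M∈α
      ... | inj₂ M∈cβ =
        ⊥-elim (ℕ.<⇒≱ (All.lookup (All.lookup above a∈α) M∈cβ)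
                      (proj₂ (IsPerm.bounded rest-perm (∈-++⁺ˡ a∈α))))
    ... | γ , d ∷ δ , refl =
      case trans (sym π-dumont) (trans (cong dumont (List.++-assoc γ (M ∷ d ∷ δ) (N ∷ c ∷ β)))
                                       (dumont-odd-descent M γ d (δ ++ N ∷ c ∷ β) M-odd d≤M)) of λ ()
      where
      d≤M : d ≤ M
      d≤M = proj₂ (IsPerm.bounded (IsPerm-remove-max (γ ++ M ∷ d ∷ δ) π-perm)
                                  (∈-++⁺ˡ (∈-++⁺ʳ γ (there (here refl)))))
    ... | γ , [] , refl with peak-decompose γ c β γcβ-perm γ-above (trans (cong dumont (sym reassoc)) π-dumont)
      where
      reassoc : (γ ++ M ∷ []) ++ N ∷ c ∷ β ≡ γ ++ M ∷ N ∷ c ∷ β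
      reassoc = List.++-assoc γ (M ∷ []) (N ∷ c ∷ β)
      γcβ-perm : IsPerm (double m) (γ ++ c ∷ β)
      γcβ-perm = IsPerm-remove-max γ (subst (IsPerm M) (List.++-assoc γ (M ∷ []) (c ∷ β))
                                                       (IsPerm-remove-max (γ ++ M ∷ []) π-perm))
      γ-above : Above γ (c ∷ β)
      γ-above = All.++⁻ˡ γ (avoids132-max-splits (γ ++ M ∷ []) (c ∷ β) π-perm π-avoids)
    ... | y , y-split , glue≡ = y , y-split , trans glue≡ (sym (List.++-assoc γ (M ∷ []) (N ∷ c ∷ β)))

    decompose : ∀ π → IsPerm N π → dumont π ≡ true → has132 π ≡ false → ∃ λ y → Split y × glue y ≡ π
    decompose π π-perm π-dumont π-avoids with ∈-∃++ (IsPerm-∋ π-perm (s≤s z≤n) ℕ.≤-refl)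
    ... | α , [] , refl = case trans (sym π-dumont) (dumont-even-last α N N-even) of λ ()
    ... | [] , c ∷ β , refl = valley-decompose c β π-perm π-dumont
    ... | a ∷ α , c ∷ β , refl = prefix-decompose (a ∷ α) c β π-perm π-dumont π-avoids (here refl)

    count-even : ∀ k → countB (admissible k) (perms N) ≡ countB (splitAdmissible k) splits
    count-even k =
      countB-bijection (admissible k) (splitAdmissible k) cut glue (perms N) splits (perms-unique N) splits-unique to to⁻¹
      where
      to : ∀ {π} → π ∈ perms N → admissible k π ≡ true →
           cut π ∈ splits × splitAdmissible k (cut π) ≡ true × glue (cut π) ≡ π
      to {π} π∈ π-adm with admissible⇒dumont-avoids132 k π π-adm
      ... | π-dumont , π-avoids with decompose π (∈-perms⁻ N π∈) π-dumont π-avoids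
      ... | y , y-split , refl rewrite cut-glue y-split =
        ∈-splits⁺ y-split , trans (sym (glue-admissible k y-split)) π-adm , refl
      to⁻¹ : ∀ {y} → y ∈ splits → splitAdmissible k y ≡ true →
             glue y ∈ perms N × admissible k (glue y) ≡ true × cut (glue y) ≡ y
      to⁻¹ y∈ y-adm = let y-split = ∈-splits⁻ y∈ in
        ∈-perms⁺ N (glue-perm y-split) , trans (glue-admissible k y-split) y-adm , cut-glue y-split

open PowerSeries
open Counting
open import Data.Integer.Base using (ℤ; +_; -_; _+_; _*_; _-_)
import Data.Integer.Properties as ℤ

D : ℕ → ℕ → ℕ
D k = Dcount (incPat k)

-- Every word contains the empty pattern.
D-zero : ∀ n → D 0 n ≡ 0
D-zero n = countB-false (admissible 0) (perms n) λ {w} _ →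
  trans (admissible-unfold 0 w) (trans (cong (dumont w ∧_) (∧-zeroʳ _)) (∧-zeroʳ _))

D-odd : ∀ k m → D k (suc (double m)) ≡ D (k ∸ 1) (double m)
D-odd = count-odd

D-even : ∀ k m → D k (double (suc m))
       ≡ sumBelowℕ (λ i → D (k ∸ 2) (double i) ℕ.* D k (double (m ∸ i))) m ℕ.+ D (k ∸ 1) (double m)
D-even k m = trans (EvenLength.count-even m k) (EvenLength.count-splits m k)

sumBelow-+ : ∀ (h : ℕ → ℕ) m → sumBelow (λ t → + h t) m ≡ + sumBelowℕ h m
sumBelow-+ h zero    = refl
sumBelow-+ h (suc m) = cong (_+ + h m) (sumBelow-+ h m)

F-double≡D-step : ∀ k → (∀ m → F k (double m) ≡ + D k (double m)) →
                       (∀ m → F (suc k) (double m) ≡ + D (suc k) (double m)) →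
                       ∀ m → F (suc (suc k)) (double m) ≡ + D (suc (suc k)) (double m)
F-double≡D-step k F≡D F′≡D′ = <-rec (λ m → F (suc (suc k)) (double m) ≡ + D (suc (suc k)) (double m)) step
  where
  step : ∀ m → (∀ {t} → t < m → F (suc (suc k)) (double t) ≡ + D (suc (suc k)) (double t)) →
         F (suc (suc k)) (double m) ≡ + D (suc (suc k)) (double m)
  step zero    _  = refl
  step (suc m) IH = begin
    F (suc (suc k)) (double (suc m))
      ≡⟨ F-double-suc k m ⟩
    F (suc k) (double m) + sumBelow (λ t → F k (double t) * F (suc (suc k)) (double (m ∸ t))) m
      ≡⟨ cong₂ _+_ (F′≡D′ m) (sumBelow-cong m (λ t _ → cong₂ _*_ (F≡D t) (IH (s≤s (ℕ.m∸n≤m m t))))) ⟩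
    + D (suc k) (double m) + sumBelow (λ t → + D k (double t) * + D (suc (suc k)) (double (m ∸ t))) m
      ≡⟨ cong (_+_ (+ D (suc k) (double m))) (trans (sumBelow-cong m (λ t _ → sym (ℤ.pos-* (D k (double t)) _)))
                                                     (sumBelow-+ _ m)) ⟩
    + D (suc k) (double m) + + sumBelowℕ (λ t → D k (double t) ℕ.* D (suc (suc k)) (double (m ∸ t))) m
      ≡⟨ cong +_ (ℕ.+-comm (D (suc k) (double m)) _) ⟩
    + (sumBelowℕ (λ t → D k (double t) ℕ.* D (suc (suc k)) (double (m ∸ t))) m ℕ.+ D (suc k) (double m))
      ≡⟨ cong +_ (sym (D-even (suc (suc k)) m)) ⟩
    + D (suc (suc k)) (double (suc m)) ∎
    where open ≡-Reasoning

F-double≡D : ∀ k m → F k (double m) ≡ + D k (double m)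
F-double≡D zero          m       = cong +_ (sym (D-zero (double m)))
F-double≡D (suc zero)    zero    = refl
F-double≡D (suc zero)    (suc m) = cong +_ (sym (trans (D-even 1 m) (cong₂ ℕ._+_ no-inner-blocks (D-zero (double m)))))
  where
  no-inner-blocks : sumBelowℕ (λ i → D 0 (double i) ℕ.* D 1 (double (m ∸ i))) m ≡ 0
  no-inner-blocks = sumBelowℕ-zero _ m (λ i → cong (ℕ._* D 1 (double (m ∸ i))) (D-zero (double i)))
F-double≡D (suc (suc k))         = F-double≡D-step k (F-double≡D k) (F-double≡D (suc k))

Odd : Series → Set
Odd f = ∀ m → f (double m) ≡ + 0

xS-odd : ∀ f → Even f → Odd (xS f)
xS-odd f f-even zero    = refl
xS-odd f f-even (suc m) = f-even m

+2* : ∀ x → + 2 * x ≡ x + x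
+2* x = trans (ℤ.*-distribʳ-+ x (+ 1) (+ 1)) (cong₂ _+_ (ℤ.*-identityˡ x) (ℤ.*-identityˡ x))

negX-double : ∀ f m → negX f (double m) ≡ f (double m)
negX-double f m rewrite evenB-double m = refl

negX-suc-double : ∀ f m → negX f (suc (double m)) ≡ - f (suc (double m))
negX-suc-double f m rewrite evenB-suc-double m = refl

even-odd-parts : ∀ d e o → Even e → Odd o → (∀ n → d n ≡ e n + o n) →
  ∀ n → (+ 2 * e n ≡ d n + negX d n) × (+ 2 * o n ≡ d n - negX d n)
even-odd-parts d e o e-even o-odd d≡e+o n with parity n
... | inj₁ (m , refl) =
  trans (+2* (e n)) (cong₂ _+_ (sym d≡e) (trans (sym d≡e) (sym (negX-double d m)))) ,
  trans (cong (+ 2 *_) (o-odd m)) (sym (trans (cong (_-_ (d n)) (negX-double d m)) (ℤ.+-inverseʳ (d n))))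
  where
  d≡e : d n ≡ e n
  d≡e = trans (d≡e+o n) (trans (cong (_+_ (e n)) (o-odd m)) (ℤ.+-identityʳ _))
... | inj₂ (m , refl) =
  trans (cong (+ 2 *_) (e-even m)) (sym (trans (cong (_+_ (d n)) (negX-suc-double d m)) (ℤ.+-inverseʳ (d n)))) ,
  trans (+2* (o n)) (cong₂ _+_ (sym d≡o) (trans (sym d≡o) (sym neg-negX≡d)))
  where
  d≡o : d n ≡ o n
  d≡o = trans (d≡e+o n) (trans (cong (_+ o n) (e-even m)) (ℤ.+-identityˡ _))
  neg-negX≡d : - negX d n ≡ d n
  neg-negX≡d = trans (cong -_ (negX-suc-double d m)) (ℤ.neg-involutive (d n))

Dgf≡F⊕xF : ∀ k n → Dgf (incPat k) n ≡ (F k ⊕ xS (F (k ∸ 1))) n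
Dgf≡F⊕xF k n with parity n
... | inj₁ (m , refl) =
  sym (trans (cong (_+_ (F k n)) (xS-odd (F (k ∸ 1)) (F-even (k ∸ 1)) m)) (trans (ℤ.+-identityʳ _) (F-double≡D k m)))
... | inj₂ (m , refl) =
  sym (trans (cong (_+ F (k ∸ 1) (double m)) (F-even k m))
             (trans (ℤ.+-identityˡ _) (trans (F-double≡D (k ∸ 1) m) (cong +_ (sym (D-odd k m))))))

theorem2p4 : (k n : ℕ) →
    ((+ 2) * F k n ≡ Dgf (incPat k) n + negX (Dgf (incPat k)) n)
    × ((+ 2) * xS (F (k ∸ 1)) n ≡ Dgf (incPat k) n - negX (Dgf (incPat k)) n)
    × (Dgf (incPat k) n ≡ (F k ⊕ xS (F (k ∸ 1))) n)
theorem2p4 k n =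
  let even-part , odd-part = even-odd-parts (Dgf (incPat k)) (F k) (xS (F (k ∸ 1)))
                                            (F-even k) (xS-odd (F (k ∸ 1)) (F-even (k ∸ 1))) (Dgf≡F⊕xF k) n
  in even-part , odd-part , Dgf≡F⊕xF k n
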